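{- Let $P$ be an $R$-labeled poset of rank $n$ with fixed $R$-labeling $\lambda$, let $\ell\ge 0$ and $T\subseteq\{0,1,\dots,n-1\}$. Then $\#\mathsf{B}_\ell(T)$ equals the number of pairs $(\mathcal{M},E)$ consisting of a maximal chain $\mathcal{M}$ of $P$ and a subset $E\subseteq\{1,\dots,n\}$ with $\#E=\ell$ such that $\mathsf{u}(\mathcal{M},E)=\mathsf{u}_T$.
   Context: A graded poset $P$ of rank $n$ is a finite poset with unique minimum $\hat 0$ (rank $0$) and unique maximum $\hat 1$ (rank $n$) such that ${\sf rank}(X)$ equals the length of every maximal chain from $\hat 0$ to $X$. A chain is a (possibly empty) totally ordered subset; ${\sf Rank}(\mathcal{C})=\{{\sf rank}(\mathcal{C}_i)\}$. An $R$-labeling is a map $\lambda$ from cover relations to positive integers such that every interval has a unique maximal chain with weakly increasing labels; $P$ is $R$-labeled if finite, graded and admitting one. For a chain $\mathcal{C}=\{\mathcal{C}_1<\dots<\mathcal{C}_k\}$, a multichain $\mathcal{D}=\{\{\mathcal{D}_1\le\dots\le\mathcal{D}_k\}\}$ interlaces $\mathcal{C}$ if $\mathcal{C}_1\le\mathcal{D}_1\le\mathcal{C}_2\le\dots\le\mathcal{C}_k\le\mathcal{D}_k$; $\mathsf{irank}(\mathcal{C},\mathcal{D})=\sum_i{\sf rank}(\mathcal{D}_i)-\sum_i{\sf rank}(\mathcal{C}_i)$. A maximal chain $\mathcal{M}=\{\mathcal{M}_0\lessdot\dots\lessdot\mathcal{M}_n\}$ decreases along $[\mathcal{M}_i,\mathcal{M}_j]$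 if $\lambda(\mathcal{M}_i,\mathcal{M}_{i+1})>\dots>\lambda(\mathcal{M}_{j-1},\mathcal{M}_j)$, and weakly increases along it if these are weakly increasing. $\mathsf{IncDec}(\mathcal{C},\mathcal{D})$: maximal chains containing all $\mathcal{C}_i,\mathcal{D}_i$, decreasing along each $[\mathcal{C}_i,\mathcal{D}_i]$ and weakly increasing along $[\hat 0,\mathcal{C}_1]$, each $[\mathcal{D}_i,\mathcal{C}_{i+1}]$ and $[\mathcal{D}_k,\hat 1]$. For $S\subseteq\{0,\dots,n-1\}$, $\mathsf{A}_\ell(S)$ is the set of triples $(\mathcal{C},\mathcal{D},\mathcal{M})$ with $\mathcal{D}$ interlacing $\mathcal{C}$, ${\sf Rank}(\mathcal{C})=S$, $\mathsf{irank}(\mathcal{C},\mathcal{D})=\ell$, $\mathcal{M}\in\mathsf{IncDec}(\mathcal{C},\mathcal{D})$. For $S\subseteq T$, $\varphi_{S,T}(\mathcal{C},\mathcal{D},\mathcal{M})=(\mathcal{C}\cup\{\mathcal{M}_r:r\in T\setminus S\},\mathcal{D}\sqcup\{\{\mathcal{M}_r:r\in T\setminus S\}\},\mathcal{M})$. $\mathsf{B}_\ell(T)=\mathsf{A}_\ell(T)\setminus\bigcup_{S\subsetneq T}\varphi_{S,T}(\mathsf{A}_\ell(S))$. $\mathsf{u}_T=w_0\cdots w_{n-1}$ with $w_i=\mathbf{b}$ if $i\in T$, $w_i=\mathbf{a}$ otherwise ($\mathbf{a},\mathbf{b}$ noncommuting letters). For a maximal chain $\mathcal{M}$, $\mathsf{u}(\mathcal{M})=u_1\cdots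 u_n$ with $u_1=\mathbf{a}$ and, for $2\le i\le n$, $u_i=\mathbf{a}$ if $\lambda(\mathcal{M}_{i-2},\mathcal{M}_{i-1})\le\lambda(\mathcal{M}_{i-1},\mathcal{M}_i)$, else $\mathbf{b}$; for $E\subseteq\{1,\dots,n\}$, $\mathsf{u}(\mathcal{M},E)=v_1\cdots v_n$ with $v_i=\mathbf{a}$ if ($u_i=\mathbf{a}$, $i\notin E$) or ($u_i=\mathbf{b}$, $i-1\in E$), and $v_i=\mathbf{b}$ if ($u_i=\mathbf{a}$, $i\in E$) or ($u_i=\mathbf{b}$, $i-1\notin E$). -}

module Defs where

open import Level using (0ℓ)
open import Data.Nat using (ℕ; zero; suc; _+_; _≤ᵇ_) renaming (_≤_ to _≤ℕ_; _<_ to _<ℕ_)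
open import Data.Bool using (Bool; true; false; if_then_else_)
open import Data.Fin using (Fin; zero; suc; toℕ; inject₁)
open import Data.Fin.Subset using (Subset; _⊂_; ∣_∣)
open import Data.Vec using (Vec; lookup; tabulate; toList) renaming (map to vmap)
open import Data.List using (List; []; _∷_; length; map; head; last; foldr)
open import Data.Nat.ListAction using (sum)
open import Data.List.Relation.Unary.All using (All)
open import Data.List.Relation.Unary.Linked using (Linked)
open import Data.List.Membership.Propositional using (_∈_)
open import Data.Maybe using (just)
open import Data.Product using (Σ; _×_; _,_)
open import Data.Unit using (⊤)
open import Data.Empty using (⊥)
open import Data.Refinement using (Refinement)
open import Relation.Nullary using (¬_)
open import Relation.Binary using (Rel; IsPartialOrder; Decidable)
open import Relation.Binary.PropositionalEquality using (_≡_; _≢_)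
open import Function.Bundles using (_↔_)

record FinPoset : Set₁ where
  field
    Carrier        : Set
    _≤_            : Rel Carrier 0ℓ
    isPartialOrder : IsPartialOrder _≡_ _≤_
    _≤?_           : Decidable _≤_
    size           : ℕ
    enum           : Fin size ↔ Carrier

data Letter : Set where
  𝐚 𝐛 : Letter

module PosetDefs (P : FinPoset) where
  open FinPoset P public

  _<_ : Rel Carrier 0ℓ
  x < y = x ≤ y × x ≢ y

  _⋖_ : Rel Carrier 0ℓ
  x ⋖ y = x < y × (∀ z → x < z → ¬ (z < y))

  SatChain : Carrier → Carrier → List Carrier → Set
  SatChain x y c = Linked _⋖_ c × head c ≡ just x × last c ≡ just y

  record Graded (n : ℕ) : Set where
    field
      bot top  : Carrier
      bot-min  : ∀ x → bot ≤ x
      top-max  : ∀ x → x ≤ top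
      rank     : Carrier → ℕ
      rank-len : ∀ x c → SatChain bot x c → length c ≡ suc (rank x)
      rank-top : rank top ≡ n

  labels : (Carrier → Carrier → ℕ) → List Carrier → List ℕ
  labels lab []           = []
  labels lab (x ∷ [])     = []
  labels lab (x ∷ y ∷ xs) = lab x y ∷ labels lab (y ∷ xs)

  -- R-labeling: positive labels on covers, and every interval [x,y]
  -- has a unique maximal chain with weakly increasing labels.
  -- (lab is only ever evaluated on cover relations.)
  record IsRLabeling (lab : Carrier → Carrier → ℕ) : Set where
    field
      positive : ∀ x y → x ⋖ y → 1 ≤ℕ lab x y
      unique-inc : ∀ x y → x ≤ y →
        Σ (List Carrier) λ c →
          (SatChain x y c × Linked _≤ℕ_ (labels lab c)) ×
          (∀ c′ → SatChain x y c′ → Linked _≤ℕ_ (labels lab c′) → c′ ≡ c)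

  module Setup (n : ℕ) (G : Graded n) (lab : Carrier → Carrier → ℕ) where
    open Graded G

    MaxChain : Vec Carrier (suc n) → Set
    MaxChain M = lookup M zero ≡ bot × lookup M (Data.Fin.fromℕ n) ≡ top ×
                 (∀ (i : Fin n) → lookup M (inject₁ i) ⋖ lookup M (suc i))

    stepLab : Vec Carrier (suc n) → Fin n → ℕ
    stepLab M k = lab (lookup M (inject₁ k)) (lookup M (suc k))

    DecAlong : Vec Carrier (suc n) → ℕ → ℕ → Set
    DecAlong M i j = ∀ (k k′ : Fin n) → toℕ k′ ≡ suc (toℕ k) →
      i ≤ℕ toℕ k → toℕ k′ <ℕ j → stepLab M k′ <ℕ stepLab M k

    IncAlong : Vec Carrier (suc n) → ℕ → ℕ → Set
    IncAlong M i j = ∀ (k k′ : Fin n) → toℕ k′ ≡ suc (toℕ k) →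
      i ≤ℕ toℕ k → toℕ k′ <ℕ j → stepLab M k ≤ℕ stepLab M k′

    IsChain : List Carrier → Set
    IsChain C = Linked _<_ C

    RankIs : List Carrier → Subset n → Set
    RankIs C S = ∀ (k : ℕ) →
      (k ∈ map rank C → Σ (Fin n) λ r → toℕ r ≡ k × lookup S r ≡ true) ×
      ((Σ (Fin n) λ r → toℕ r ≡ k × lookup S r ≡ true) → k ∈ map rank C)

    Interlaces : List Carrier → List Carrier → Set
    Interlaces [] [] = ⊤
    Interlaces (c ∷ []) (d ∷ []) = c ≤ d
    Interlaces (c ∷ c′ ∷ cs) (d ∷ d′ ∷ ds) = c ≤ d × d ≤ c′ × Interlaces (c′ ∷ cs) (d′ ∷ ds)
    Interlaces _ _ = ⊥

    IRank : List Carrier → List Carrier → ℕ → Set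
    IRank C D ℓ = sum (map rank D) ≡ ℓ + sum (map rank C)

    -- alternating increasing/decreasing conditions, with ranks as positions
    -- in M: weakly increasing on [s, C₁], decreasing on [C₁,D₁], weakly
    -- increasing on [D₁,C₂], …, decreasing on [C_k,D_k], weakly increasing
    -- on [D_k, 1̂].
    IncDecPattern : Vec Carrier (suc n) → ℕ → List Carrier → List Carrier → Set
    IncDecPattern M s [] [] = IncAlong M s n
    IncDecPattern M s (c ∷ cs) (d ∷ ds) =
      IncAlong M s (rank c) × DecAlong M (rank c) (rank d) × IncDecPattern M (rank d) cs ds
    IncDecPattern M s _ _ = ⊥

    IncDec : List Carrier → List Carrier → Vec Carrier (suc n) → Set
    IncDec C D M = MaxChain M ×
      All (λ x → x ∈ toList M) C × All (λ x → x ∈ toList M) D ×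
      IncDecPattern M 0 C D

    Triple : Set
    Triple = List Carrier × List Carrier × Vec Carrier (suc n)

    InA : ℕ → Subset n → Triple → Set
    InA ℓ S (C , D , M) = IsChain C × Interlaces C D × RankIs C S ×
      IRank C D ℓ × IncDec C D M

    insertR : Carrier → List Carrier → List Carrier
    insertR x [] = x ∷ []
    insertR x (y ∷ ys) = if rank x ≤ᵇ rank y then x ∷ y ∷ ys else y ∷ insertR x ys

    extra : Subset n → Subset n → Vec Carrier (suc n) → List Carrier
    extra S T M = foldr (λ r acc → if lookup T r then
                                     (if lookup S r then acc else lookup M (inject₁ r) ∷ acc)
                                   else acc)
                        [] (Data.List.allFin n)

    φ : Subset n → Subset n → Triple → Triple
    φ S T (C , D , M) = foldr insertR C (extra S T M) , foldr insertR D (extra S T M) , M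

    B : ℕ → Subset n → Set
    B ℓ T = Refinement Triple λ x → InA ℓ T x ×
      ¬ (Σ (Subset n) λ S → S ⊂ T × Σ Triple λ y → InA ℓ S y × φ S T y ≡ x)

    uT : Subset n → Vec Letter n
    uT T = vmap (λ β → if β then 𝐛 else 𝐚) T

    uAux : (Fin n → ℕ) → Fin n → Letter
    uAux = go
      where
      go : ∀ {m} → (Fin m → ℕ) → Fin m → Letter
      go s zero    = 𝐚
      go s (suc i) = if s (inject₁ i) ≤ᵇ s (suc i) then 𝐚 else 𝐛

    -- u(M) = u₁ ⋯ uₙ  (index i ↦ position i+1)
    uM : Vec Carrier (suc n) → Vec Letter n
    uM M = tabulate (uAux (stepLab M))

    -- E ⊆ {1,…,n} encoded as Subset n (index i ↦ element i+1)
    prevIn : ∀ {m} → Subset m → Fin m → Bool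
    prevIn E zero    = false
    prevIn E (suc i) = lookup E (inject₁ i)

    letterV : Letter → Bool → Bool → Letter
    letterV 𝐚 inE prev = if inE then 𝐛 else 𝐚
    letterV 𝐛 inE prev = if prev then 𝐚 else 𝐛

    uME : Vec Carrier (suc n) → Subset n → Vec Letter n
    uME M E = tabulate (λ i → letterV (lookup (uM M) i) (lookup E i) (prevIn E i))

    Pairs : ℕ → Subset n → Set
    Pairs ℓ T = Refinement (Vec Carrier (suc n) × Subset n) λ { (M , E) →
      MaxChain M × ∣ E ∣ ≡ ℓ × uME M E ≡ uT T }

{-# OPTIONS --safe #-}

-- Everything happens inside one maximal chain M.  The chains C and D of a triple (C, D, M) lie
-- on M, so they are determined by their ranks c₁ < ⋯ < c_k and d₁ ≤ ⋯ ≤ d_k, which interlace;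
-- record them by E = ⋃ (cᵢ, dᵢ] ⊆ {1, …, n}, so that #E = irank(C, D).  Conversely C and D are
-- rebuilt from Rank(C) = T and E, and the conditions IncDec(C, D) become a condition at each
-- position v in terms of [v ∈ T], [v ∈ E], [v+1 ∈ E] and whether λ ascends at M_v.  The triple
-- lies in some φ_{S,T}(A_ℓ(S)) with S ⊊ T exactly when some v ∈ T can be dropped from C without
-- violating these conditions.  Read letter by letter, "the local conditions hold and no point
-- of T can be dropped" is precisely u(M, E) = u_T.
module Submission where

open import Algebra.Properties.CommutativeSemigroup using (interchange; x∙yz≈y∙xz)
open import Data.Bool using (Bool; true; false; not; _∧_; _∨_; if_then_else_)
import Data.Bool as Bool
open import Data.Bool.Properties using (∧-identityʳ; ∨-zeroʳ; not-injective; T-≡; ¬-not; ⇔→≡)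
open import Data.Empty using (⊥; ⊥-elim)
open import Data.Fin using (Fin; zero; suc; toℕ; inject₁; fromℕ<)
open import Data.Fin.Properties using (toℕ-inject₁; toℕ-fromℕ<; toℕ<n; inj⇒≟)
open import Data.Fin.Subset using (Subset; ∣_∣; _-_; _⊂_)
open import Data.Fin.Subset.Properties using (p─⊥≡p; x∈p⇒p-x⊂p)
open import Data.Irrelevant using ([_])
open import Data.List using (List; []; _∷_; length; map; replicate; _++_; foldr; allFin; head; last)
open import Data.List.Membership.Propositional using (_∈_)
open import Data.List.Properties using (map-tabulate; foldr-map)
import Data.List.Properties as ListP
open import Data.List.Relation.Unary.All as All using (All; []; _∷_)
import Data.List.Relation.Unary.All.Properties as AllP
open import Data.List.Relation.Unary.Any using (here; there)
open import Data.List.Relation.Unary.Linked as Linked using (Linked; []; [-]; _∷_)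
open import Data.List.Relation.Unary.Linked.Properties using (Linked⇒All)
open import Data.Maybe using (just)
open import Data.Nat using (ℕ; zero; suc; _+_; _*_; _≤_; _<_; z≤n; s≤s; _<?_; _≟_; _<ᵇ_; _≤ᵇ_; _≡ᵇ_)
open import Data.Nat.ListAction using (sum)
open import Data.Nat.Properties
open import Data.Product using (Σ; _×_; _,_; proj₁; proj₂)
open import Data.Product.Properties using (≡-dec)
open import Data.Refinement using (value-injective) renaming (_,_ to _&_)
open import Data.Sum using (inj₁; inj₂)
open import Data.Unit using (⊤; tt)
open import Data.Vec using (Vec; []; _∷_; lookup; tabulate; toList)
open import Data.Vec.Properties
  using (lookup⇒[]=; []=⇒lookup; lookup∘tabulate; lookup-map; tabulate∘lookup; tabulate-cong)
import Data.Vec.Properties as VecP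
open import Function using (_∘_; id)
open import Function.Bundles using (Equivalence; mk⇔; _↔_; mk↔ₛ′)
open import Function.Properties.Inverse using (↔⇒↣; ↔-sym)
open import Relation.Binary using (DecidableEquality; IsPartialOrder; tri<; tri≈; tri>)
open import Relation.Binary.PropositionalEquality
  using (_≡_; _≢_; refl; sym; trans; cong; cong₂; subst; subst₂; module ≡-Reasoning)
open import Relation.Nullary using (¬_; yes; no)
open import Relation.Nullary.Decidable using (recompute)

open import Defs

private
  +-interchange : ∀ a b c d → a + b + (c + d) ≡ a + c + (b + d)
  +-interchange = interchange +-commutativeSemigroup

  +-left-comm : ∀ a b c → a + (b + c) ≡ b + (a + c)
  +-left-comm = x∙yz≈y∙xz +-commutativeSemigroup

false≢true : false ≢ true
false≢true ()

𝟙 : Bool → ℕ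
𝟙 true  = 1
𝟙 false = 0

𝟙-injective : ∀ {a b} → 𝟙 a ≡ 𝟙 b → a ≡ b
𝟙-injective {true}  {true}  _ = refl
𝟙-injective {false} {false} _ = refl

𝟙≤1 : ∀ b → 𝟙 b ≤ 1
𝟙≤1 true  = ≤-refl
𝟙≤1 false = z≤n

<ᵇ-true : ∀ {m n} → m < n → (m <ᵇ n) ≡ true
<ᵇ-true {zero}  {suc n} _         = refl
<ᵇ-true {suc m} {suc n} (s≤s m<n) = <ᵇ-true m<n

<ᵇ-false : ∀ {m n} → n ≤ m → (m <ᵇ n) ≡ false
<ᵇ-false {m}     {zero}  _         = refl
<ᵇ-false {suc m} {suc n} (s≤s n≤m) = <ᵇ-false n≤m

<ᵇ-true⁻ : ∀ m n → (m <ᵇ n) ≡ true → m < n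
<ᵇ-true⁻ zero    (suc n) _ = s≤s z≤n
<ᵇ-true⁻ (suc m) (suc n) e = s≤s (<ᵇ-true⁻ m n e)

<ᵇ-false⁻ : ∀ m n → (m <ᵇ n) ≡ false → n ≤ m
<ᵇ-false⁻ m       zero    _ = z≤n
<ᵇ-false⁻ (suc m) (suc n) e = s≤s (<ᵇ-false⁻ m n e)

<ᵇ-irrefl : ∀ m → (m <ᵇ m) ≡ false
<ᵇ-irrefl m = <ᵇ-false {m} ≤-refl

<ᵇ-+𝟙 : ∀ m b → (m <ᵇ m + 𝟙 b) ≡ b
<ᵇ-+𝟙 m true  = <ᵇ-true {m} {m + 1} (m<m+n m (s≤s z≤n))
<ᵇ-+𝟙 m false = <ᵇ-false {m} {m + 0} (≤-reflexive (+-identityʳ m))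

<ᵇ-+-cancelˡ : ∀ k a b → (k + a <ᵇ k + b) ≡ (a <ᵇ b)
<ᵇ-+-cancelˡ zero    a b = refl
<ᵇ-+-cancelˡ (suc k) a b = <ᵇ-+-cancelˡ k a b

<ᵇ-suc : ∀ m q → 𝟙 (m <ᵇ suc q) ≡ 𝟙 (m <ᵇ q) + 𝟙 (m ≡ᵇ q)
<ᵇ-suc zero    zero    = refl
<ᵇ-suc zero    (suc q) = refl
<ᵇ-suc (suc m) zero    = refl
<ᵇ-suc (suc m) (suc q) = <ᵇ-suc m q

≡ᵇ-true⁻ : ∀ m n → (m ≡ᵇ n) ≡ true → m ≡ n
≡ᵇ-true⁻ zero    zero    _ = refl
≡ᵇ-true⁻ (suc m) (suc n) e = cong suc (≡ᵇ-true⁻ m n e)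

≡ᵇ-refl : ∀ m → (m ≡ᵇ m) ≡ true
≡ᵇ-refl zero    = refl
≡ᵇ-refl (suc m) = ≡ᵇ-refl m

≡ᵇ-false : ∀ {m n} → m ≢ n → (m ≡ᵇ n) ≡ false
≡ᵇ-false {zero}  {zero}  m≢n = ⊥-elim (m≢n refl)
≡ᵇ-false {zero}  {suc n} _   = refl
≡ᵇ-false {suc m} {zero}  _   = refl
≡ᵇ-false {suc m} {suc n} m≢n = ≡ᵇ-false (m≢n ∘ cong suc)

≤⇔≤ᵇ : ∀ x y → (x ≤ y → (x ≤ᵇ y) ≡ true) × ((x ≤ᵇ y) ≡ true → x ≤ y)
≤⇔≤ᵇ x y = Equivalence.to T-≡ ∘ ≤⇒≤ᵇ , ≤ᵇ⇒≤ x y ∘ Equivalence.from T-≡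

>⇔≤ᵇ : ∀ x y → (y < x → (x ≤ᵇ y) ≡ false) × ((x ≤ᵇ y) ≡ false → y < x)
>⇔≤ᵇ x y = (λ y<x → ¬-not (λ x≤ᵇy → <⇒≱ y<x (proj₂ (≤⇔≤ᵇ x y) x≤ᵇy)))
         , (λ x≤ᵇy → ≰⇒> (λ x≤y → false≢true (trans (sym x≤ᵇy) (proj₁ (≤⇔≤ᵇ x y) x≤y))))

head-bounds : ∀ {A : Set} {R : A → A → Set} → (∀ {a b c} → R a b → R b c → R a c) →
              ∀ {a l} → Linked R (a ∷ l) → All (R a) l
head-bounds trans [-]     = []
head-bounds trans (p ∷ r) = Linked⇒All trans p r

linked-∷ : ∀ {A : Set} {R : A → A → Set} {a l} → All (R a) l → Linked R l → Linked R (a ∷ l)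
linked-∷ []      []  = [-]
linked-∷ (p ∷ _) lk = p ∷ lk

countBelow : ℕ → List ℕ → ℕ
countBelow q []      = 0
countBelow q (a ∷ l) = 𝟙 (a <ᵇ q) + countBelow q l

multiplicity : ℕ → List ℕ → ℕ
multiplicity q []      = 0
multiplicity q (a ∷ l) = 𝟙 (a ≡ᵇ q) + multiplicity q l

_∈ᵇ_ : ℕ → List ℕ → Bool
q ∈ᵇ []      = false
q ∈ᵇ (a ∷ l) = (a ≡ᵇ q) ∨ (q ∈ᵇ l)

countBelow-zero : ∀ l → countBelow 0 l ≡ 0
countBelow-zero []      = refl
countBelow-zero (a ∷ l) = countBelow-zero l

countBelow-suc : ∀ q l → countBelow (suc q) l ≡ countBelow q l + multiplicity q l
countBelow-suc q []      = refl
countBelow-suc q (a ∷ l) rewrite <ᵇ-suc a q | countBelow-suc q l =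
  +-interchange (𝟙 (a <ᵇ q)) (𝟙 (a ≡ᵇ q)) (countBelow q l) (multiplicity q l)

countBelow-none : ∀ {q} l → All (q ≤_) l → countBelow q l ≡ 0
countBelow-none []      []       = refl
countBelow-none (a ∷ l) (q≤a ∷ ps) rewrite <ᵇ-false q≤a = countBelow-none l ps

countBelow-all : ∀ {q} l → All (_< q) l → countBelow q l ≡ length l
countBelow-all []      []       = refl
countBelow-all (a ∷ l) (a<q ∷ ps) rewrite <ᵇ-true a<q = cong suc (countBelow-all l ps)

multiplicity-none : ∀ {q} l → All (q <_) l → multiplicity q l ≡ 0
multiplicity-none []      []       = refl
multiplicity-none {q} (a ∷ l) (q<a ∷ ps)
  rewrite ≡ᵇ-false {a} {q} (λ a≡q → <-irrefl (sym a≡q) q<a) = multiplicity-none l ps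

∈ᵇ-none : ∀ {q} l → All (q <_) l → (q ∈ᵇ l) ≡ false
∈ᵇ-none []      []       = refl
∈ᵇ-none {q} (a ∷ l) (q<a ∷ ps)
  rewrite ≡ᵇ-false {a} {q} (λ a≡q → <-irrefl (sym a≡q) q<a) = ∈ᵇ-none l ps

≤-∉⇒< : ∀ {q} l → All (q ≤_) l → (q ∈ᵇ l) ≡ false → All (q <_) l
≤-∉⇒< []      []         _ = []
≤-∉⇒< {q} (a ∷ l) (q≤a ∷ ps) e with a ≡ᵇ q in a≡ᵇq
... | false = ≤∧≢⇒< q≤a (λ q≡a → false≢true (trans (sym a≡ᵇq) (subst (λ z → (z ≡ᵇ q) ≡ true) q≡a (≡ᵇ-refl q))))
            ∷ ≤-∉⇒< l ps e

∈ᵇ⇒∈ : ∀ q l → (q ∈ᵇ l) ≡ true → q ∈ l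
∈ᵇ⇒∈ q (a ∷ l) e with a ≡ᵇ q in a≡ᵇq
... | true  = here (sym (≡ᵇ-true⁻ a q a≡ᵇq))
... | false = there (∈ᵇ⇒∈ q l e)

∈⇒∈ᵇ : ∀ {q} l → q ∈ l → (q ∈ᵇ l) ≡ true
∈⇒∈ᵇ {q} (a ∷ l) (here refl) rewrite ≡ᵇ-refl q = refl
∈⇒∈ᵇ {q} (a ∷ l) (there q∈l) rewrite ∈⇒∈ᵇ l q∈l = ∨-zeroʳ (a ≡ᵇ q)

multiplicity-∉ : ∀ q l → (q ∈ᵇ l) ≡ false → multiplicity q l ≡ 0
multiplicity-∉ q []      _ = refl
multiplicity-∉ q (a ∷ l) e with a ≡ᵇ q
... | false = multiplicity-∉ q l e

multiplicity-strict : ∀ q l → Linked _<_ l → multiplicity q l ≡ 𝟙 (q ∈ᵇ l)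
multiplicity-strict q []      _  = refl
multiplicity-strict q (a ∷ l) lk with a ≡ᵇ q in a≡ᵇq
... | true rewrite ≡ᵇ-true⁻ a q a≡ᵇq = cong suc (multiplicity-none l (head-bounds <-trans lk))
... | false = multiplicity-strict q l (Linked.tail lk)

multiplicity-replicate-++ : ∀ j p q l → multiplicity q (replicate j p ++ l) ≡ j * 𝟙 (p ≡ᵇ q) + multiplicity q l
multiplicity-replicate-++ zero    p q l = refl
multiplicity-replicate-++ (suc j) p q l =
  trans (cong (𝟙 (p ≡ᵇ q) +_) (multiplicity-replicate-++ j p q l)) (sym (+-assoc (𝟙 (p ≡ᵇ q)) _ _))

countBelow-from-multiplicity : ∀ l₁ l₂ → (∀ q → multiplicity q l₁ ≡ multiplicity q l₂) →
                               ∀ q → countBelow q l₁ ≡ countBelow q l₂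
countBelow-from-multiplicity l₁ l₂ h zero    = trans (countBelow-zero l₁) (sym (countBelow-zero l₂))
countBelow-from-multiplicity l₁ l₂ h (suc q) rewrite countBelow-suc q l₁ | countBelow-suc q l₂ =
  cong₂ _+_ (countBelow-from-multiplicity l₁ l₂ h q) (h q)

countBelow-head : ∀ a l → countBelow (suc a) (a ∷ l) ≡ suc (countBelow (suc a) l)
countBelow-head a l rewrite <ᵇ-true (≤-refl {suc a}) = refl

countBelow-above : ∀ {a b l} → a < b → Linked _≤_ (b ∷ l) → countBelow (suc a) (b ∷ l) ≡ 0
countBelow-above a<b s = countBelow-none (_ ∷ _) (a<b ∷ All.map (<-≤-trans a<b) (head-bounds ≤-trans s))

sorted-≡-by-countBelow : ∀ l₁ l₂ → Linked _≤_ l₁ → Linked _≤_ l₂ →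
                         (∀ q → countBelow q l₁ ≡ countBelow q l₂) → l₁ ≡ l₂
sorted-≡-by-countBelow []       []       _  _  _ = refl
sorted-≡-by-countBelow []       (b ∷ l₂) _  _  h = ⊥-elim (0≢1+n (trans (h (suc b)) (countBelow-head b l₂)))
sorted-≡-by-countBelow (a ∷ l₁) []       _  _  h = ⊥-elim (0≢1+n (trans (sym (h (suc a))) (countBelow-head a l₁)))
sorted-≡-by-countBelow (a ∷ l₁) (b ∷ l₂) s₁ s₂ h with <-cmp a b
... | tri< a<b _ _ =
  ⊥-elim (0≢1+n (trans (sym (countBelow-above a<b s₂)) (trans (sym (h (suc a))) (countBelow-head a l₁))))
... | tri> _ _ b<a =
  ⊥-elim (0≢1+n (trans (sym (countBelow-above b<a s₁)) (trans (h (suc b)) (countBelow-head b l₂))))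
... | tri≈ _ refl _ = cong (a ∷_) (sorted-≡-by-countBelow l₁ l₂ (Linked.tail s₁) (Linked.tail s₂)
        (λ q → +-cancelˡ-≡ (𝟙 (a <ᵇ q)) _ _ (h q)))

countBelow-∷< : ∀ {a q} l → a < q → countBelow q (a ∷ l) ≡ suc (countBelow q l)
countBelow-∷< l a<q rewrite <ᵇ-true a<q = refl

-- Interlaced rank sequences and the points they cover

Interlaced : ℕ → List ℕ → List ℕ → Set
Interlaced s []      []      = ⊤
Interlaced s (a ∷ c) (b ∷ d) = s ≤ a × a ≤ b × Interlaced b c d
Interlaced s []      (_ ∷ _) = ⊥
Interlaced s (_ ∷ _) []      = ⊥

-- covered c d q holds iff q lies in one of the intervals (cᵢ, dᵢ].
covered : List ℕ → List ℕ → ℕ → Bool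
covered c d q = countBelow q d <ᵇ countBelow q c

Interlaced-lowerᶜ : ∀ {s} c d → Interlaced s c d → All (s ≤_) c
Interlaced-lowerᶜ []      []      _               = []
Interlaced-lowerᶜ (a ∷ c) (b ∷ d) (s≤a , a≤b , r) =
  s≤a ∷ All.map (≤-trans (≤-trans s≤a a≤b)) (Interlaced-lowerᶜ c d r)

Interlaced-lowerᵈ : ∀ {s} c d → Interlaced s c d → All (s ≤_) d
Interlaced-lowerᵈ []      []      _               = []
Interlaced-lowerᵈ (a ∷ c) (b ∷ d) (s≤a , a≤b , r) =
  ≤-trans s≤a a≤b ∷ All.map (≤-trans (≤-trans s≤a a≤b)) (Interlaced-lowerᵈ c d r)

Interlaced-length : ∀ {s} c d → Interlaced s c d → length c ≡ length d
Interlaced-length []      []      _           = refl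
Interlaced-length (a ∷ c) (b ∷ d) (_ , _ , r) = cong suc (Interlaced-length c d r)

Interlaced-sortedᵈ : ∀ {s} c d → Interlaced s c d → Linked _≤_ d
Interlaced-sortedᵈ []           []           _ = []
Interlaced-sortedᵈ (a ∷ [])     (b ∷ [])     _ = [-]
Interlaced-sortedᵈ (a ∷ a′ ∷ c) (b ∷ b′ ∷ d) (_ , _ , r@(b≤a′ , a′≤b′ , _)) =
  ≤-trans b≤a′ a′≤b′ ∷ Interlaced-sortedᵈ (a′ ∷ c) (b′ ∷ d) r

countBelow-Interlaced-gap : ∀ {s} c d → Interlaced s c d → ∀ q →
                            Σ Bool λ β → countBelow q c ≡ countBelow q d + 𝟙 β
countBelow-Interlaced-gap []      []      _             q = false , refl
countBelow-Interlaced-gap (a ∷ c) (b ∷ d) (_ , a≤b , r) q with b <ᵇ q in b<ᵇq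
... | true with countBelow-Interlaced-gap c d r q
...   | β , h = β , trans (countBelow-∷< c (≤-<-trans a≤b (<ᵇ-true⁻ b q b<ᵇq))) (cong suc h)
countBelow-Interlaced-gap (a ∷ c) (b ∷ d) (_ , a≤b , r) q | false
  rewrite countBelow-none c (All.map (≤-trans (<ᵇ-false⁻ b q b<ᵇq)) (Interlaced-lowerᶜ c d r))
        | countBelow-none d (All.map (≤-trans (<ᵇ-false⁻ b q b<ᵇq)) (Interlaced-lowerᵈ c d r))
  = (a <ᵇ q) , +-identityʳ _

countBelow-Interlaced : ∀ {s} c d → Interlaced s c d → ∀ q →
                        countBelow q c ≡ countBelow q d + 𝟙 (covered c d q)
countBelow-Interlaced c d il q with countBelow-Interlaced-gap c d il q
... | β , h rewrite h | <ᵇ-+𝟙 (countBelow q d) β = refl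

covered-zero : ∀ c d → covered c d 0 ≡ false
covered-zero c d rewrite countBelow-zero c = refl

covered-beyond : ∀ {s q} c d → Interlaced s c d → All (_< q) c → All (_< q) d → covered c d q ≡ false
covered-beyond c d il c<q d<q
  rewrite countBelow-all c c<q | countBelow-all d d<q | Interlaced-length c d il = <ᵇ-irrefl (length d)

covered-closed : ∀ c d q → covered c d (suc q) ≡ true → (q ∈ᵇ c) ≡ false → covered c d q ≡ true
covered-closed c d q cov q∉c = <ᵇ-true (begin-strict
  countBelow q d                        ≤⟨ m≤m+n _ _ ⟩
  countBelow q d + multiplicity q d     ≡⟨ countBelow-suc q d ⟨
  countBelow (suc q) d                  <⟨ <ᵇ-true⁻ _ _ cov ⟩
  countBelow (suc q) c                  ≡⟨ countBelow-suc q c ⟩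
  countBelow q c + multiplicity q c     ≡⟨ cong (countBelow q c +_) (multiplicity-∉ q c q∉c) ⟩
  countBelow q c + 0                    ≡⟨ +-identityʳ _ ⟩
  countBelow q c                        ∎)
  where open ≤-Reasoning

Interlaced-by-counts : ∀ s c d → Linked _<_ c → Linked _≤_ d → All (s ≤_) c → length c ≡ length d →
                       (∀ q → countBelow q d ≤ countBelow q c) →
                       (∀ q → countBelow q c ≤ suc (countBelow q d)) → Interlaced s c d
Interlaced-by-counts s []      []      _  _  _          _   _  _  = tt
Interlaced-by-counts s (a ∷ c) (b ∷ d) sc sd (s≤a ∷ _) len lo hi =
  s≤a , a≤b , Interlaced-by-counts b c d (Linked.tail sc) (Linked.tail sd) (b≤c c sc hi) (suc-injective len) lo′ hi′
  where
  a≤b : a ≤ b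
  a≤b = ≮⇒≥ λ b<a → <⇒≱ (s≤s z≤n)
    (subst₂ _≤_ (countBelow-head b d) (countBelow-above b<a (Linked.map <⇒≤ sc)) (lo (suc b)))

  b≤c : ∀ c → Linked _<_ (a ∷ c) → (∀ q → countBelow q (a ∷ c) ≤ suc (countBelow q (b ∷ d))) → All (b ≤_) c
  b≤c []        _  _  = []
  b≤c (a′ ∷ c′) sc hi = All.map (≤-trans b≤a′) (≤-refl ∷ All.map <⇒≤ (head-bounds <-trans (Linked.tail sc)))
    where
    b≤a′ : b ≤ a′
    b≤a′ = ≮⇒≥ λ a′<b → <⇒≱ (s≤s (s≤s z≤n))
      (subst₂ _≤_ (trans (countBelow-∷< (a′ ∷ c′) (≤-<-trans (<⇒≤ (Linked.head sc)) (n<1+n a′)))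
                         (cong suc (countBelow-head a′ c′)))
                  (cong suc (countBelow-above a′<b sd))
                  (hi (suc a′)))

  lo′ : ∀ q → countBelow q d ≤ countBelow q c
  lo′ q with b <? q
  ... | yes b<q = ≤-pred (subst₂ _≤_ (countBelow-∷< d b<q) (countBelow-∷< c (≤-<-trans a≤b b<q)) (lo q))
  ... | no b≮q = subst (_≤ countBelow q c)
    (sym (countBelow-none d (All.map (≤-trans (≮⇒≥ b≮q)) (head-bounds ≤-trans sd)))) z≤n

  hi′ : ∀ q → countBelow q c ≤ suc (countBelow q d)
  hi′ q with b <? q
  ... | yes b<q = ≤-pred (subst₂ _≤_ (countBelow-∷< c (≤-<-trans a≤b b<q)) (cong suc (countBelow-∷< d b<q)) (hi q))
  ... | no b≮q = subst (_≤ suc (countBelow q d))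
    (sym (countBelow-none c (All.map (≤-trans (≮⇒≥ b≮q)) (b≤c c sc hi)))) z≤n

sumTo : ℕ → (ℕ → ℕ) → ℕ
sumTo zero    f = 0
sumTo (suc k) f = f 0 + sumTo k (f ∘ suc)

sumTo-+ : ∀ k f g → sumTo k (λ i → f i + g i) ≡ sumTo k f + sumTo k g
sumTo-+ zero    f g = refl
sumTo-+ (suc k) f g rewrite sumTo-+ k (f ∘ suc) (g ∘ suc) =
  +-interchange (f 0) (g 0) (sumTo k (f ∘ suc)) (sumTo k (g ∘ suc))

sumTo-cong : ∀ k {f g} → (∀ i → f i ≡ g i) → sumTo k f ≡ sumTo k g
sumTo-cong zero    h = refl
sumTo-cong (suc k) h = cong₂ _+_ (h 0) (sumTo-cong k (h ∘ suc))

sumTo-const : ∀ k c → sumTo k (λ _ → c) ≡ k * c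
sumTo-const zero    c = refl
sumTo-const (suc k) c = cong (c +_) (sumTo-const k c)

sumTo-threshold : ∀ k a → a ≤ k → sumTo k (λ i → 𝟙 (a <ᵇ suc i)) + a ≡ k
sumTo-threshold k       zero    _         = trans (+-identityʳ _) (trans (sumTo-const k 1) (*-identityʳ k))
sumTo-threshold (suc k) (suc a) (s≤s a≤k) = trans (+-suc _ a) (cong suc (sumTo-threshold k a a≤k))

sumTo-countBelow : ∀ k l → All (_≤ k) l → sumTo k (λ i → countBelow (suc i) l) + sum l ≡ k * length l
sumTo-countBelow k []      []         = trans (+-identityʳ _) (sumTo-const k 0)
sumTo-countBelow k (a ∷ l) (a≤k ∷ ps) = begin
  sumTo k (λ i → 𝟙 (a <ᵇ suc i) + countBelow (suc i) l) + (a + sum l)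
    ≡⟨ cong (_+ (a + sum l)) (sumTo-+ k _ _) ⟩
  sumTo k (λ i → 𝟙 (a <ᵇ suc i)) + sumTo k (λ i → countBelow (suc i) l) + (a + sum l)
    ≡⟨ +-interchange (sumTo k (λ i → 𝟙 (a <ᵇ suc i))) (sumTo k (λ i → countBelow (suc i) l)) a (sum l) ⟩
  (sumTo k (λ i → 𝟙 (a <ᵇ suc i)) + a) + (sumTo k (λ i → countBelow (suc i) l) + sum l)
    ≡⟨ cong₂ _+_ (sumTo-threshold k a a≤k) (sumTo-countBelow k l ps) ⟩
  k + k * length l
    ≡⟨ *-suc k (length l) ⟨
  k * suc (length l) ∎
  where open ≡-Reasoning

sum-Interlaced : ∀ k c d → Interlaced 0 c d → All (_≤ k) c → All (_≤ k) d →
                 sum d ≡ sumTo k (λ i → 𝟙 (covered c d (suc i))) + sum c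
sum-Interlaced k c d il c≤k d≤k = +-cancelˡ-≡ (countsᵈ) _ _ (begin
  countsᵈ + sum d                     ≡⟨ sumTo-countBelow k d d≤k ⟩
  k * length d                        ≡⟨ cong (k *_) (Interlaced-length c d il) ⟨
  k * length c                        ≡⟨ sumTo-countBelow k c c≤k ⟨
  countsᶜ + sum c                     ≡⟨ cong (_+ sum c) countsᶜ≡ ⟩
  countsᵈ + coveredCount + sum c      ≡⟨ +-assoc countsᵈ coveredCount (sum c) ⟩
  countsᵈ + (coveredCount + sum c)    ∎)
  where
  open ≡-Reasoning
  countsᶜ = sumTo k (λ i → countBelow (suc i) c)
  countsᵈ = sumTo k (λ i → countBelow (suc i) d)
  coveredCount = sumTo k (λ i → 𝟙 (covered c d (suc i)))
  countsᶜ≡ : countsᶜ ≡ countsᵈ + coveredCount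
  countsᶜ≡ = trans (sumTo-cong k (λ i → countBelow-Interlaced c d il (suc i))) (sumTo-+ k _ _)

-- The IncDec conditions, position by position

-- The IncDec condition at a position v, for t = [v ∈ c], xv = covered v, xs = covered (v+1) and
-- a = [λ ascends weakly at M_v]: a point outside c must be an ascent if it is uncovered and a
-- descent if it lies strictly inside an interval.
patternAt : Bool → Bool → Bool → Bool → Bool
patternAt t xv xs a = (t ∨ xv ∨ a) ∧ (t ∨ not xv ∨ not xs ∨ not a)

patternAt-start : ∀ t xs → patternAt t false xs true ≡ true
patternAt-start true  xs = refl
patternAt-start false xs = refl

module Pattern (n : ℕ) (ascent : ℕ → Bool) where

  AscendsOn : ℕ → ℕ → Set
  AscendsOn i j = ∀ v → i < v → v < j → v < n → ascent v ≡ true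

  DescendsOn : ℕ → ℕ → Set
  DescendsOn i j = ∀ v → i < v → v < j → v < n → ascent v ≡ false

  Alternates : ℕ → List ℕ → List ℕ → Set
  Alternates s []      []      = AscendsOn s n
  Alternates s (a ∷ c) (b ∷ d) = AscendsOn s a × DescendsOn a b × Alternates b c d
  Alternates s []      (_ ∷ _) = ⊥
  Alternates s (_ ∷ _) []      = ⊥

  patternOf : List ℕ → List ℕ → ℕ → Bool
  patternOf c d v = patternAt (v ∈ᵇ c) (covered c d v) (covered c d (suc v)) (ascent v)

  patternOf-[] : ∀ v → patternOf [] [] v ≡ ascent v
  patternOf-[] v = ∧-identityʳ (ascent v)

  module FirstInterval (a b : ℕ) (c d : List ℕ) (a≤b : a ≤ b) (b≤c : All (b ≤_) c) (b≤d : All (b ≤_) d) where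

    patternOf-before : ∀ v → v < a → patternOf (a ∷ c) (b ∷ d) v ≡ ascent v
    patternOf-before v v<a
      rewrite ≡ᵇ-false {a} {v} (λ e → <-irrefl (sym e) v<a)
            | ∈ᵇ-none c (All.map (<-≤-trans (<-≤-trans v<a a≤b)) b≤c)
            | <ᵇ-false {a} {v} (<⇒≤ v<a) | <ᵇ-false {b} {v} (<⇒≤ (<-≤-trans v<a a≤b))
            | countBelow-none {v} c (All.map (≤-trans (<⇒≤ (<-≤-trans v<a a≤b))) b≤c)
      = ∧-identityʳ (ascent v)

    patternOf-inside : ∀ v → a < v → v < b → patternOf (a ∷ c) (b ∷ d) v ≡ not (ascent v)
    patternOf-inside v a<v v<b
      rewrite ≡ᵇ-false {a} {v} (λ e → <-irrefl e a<v)
            | ∈ᵇ-none c (All.map (<-≤-trans v<b) b≤c)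
            | <ᵇ-true a<v | <ᵇ-false {b} {v} (<⇒≤ v<b)
            | <ᵇ-true (<-trans a<v (n<1+n v)) | <ᵇ-false {b} {suc v} v<b
            | countBelow-none {v} c (All.map (≤-trans (<⇒≤ v<b)) b≤c)
            | countBelow-none {v} d (All.map (≤-trans (<⇒≤ v<b)) b≤d)
            | countBelow-none {suc v} c (All.map (≤-trans v<b) b≤c)
            | countBelow-none {suc v} d (All.map (≤-trans v<b) b≤d)
      = refl

    patternOf-start : patternOf (a ∷ c) (b ∷ d) a ≡ true
    patternOf-start rewrite ≡ᵇ-refl a = refl

    patternOf-end : a < b → patternOf (a ∷ c) (b ∷ d) b ≡ true
    patternOf-end a<b rewrite ≡ᵇ-false {a} {b} (λ e → <-irrefl e a<b) with b ∈ᵇ c in b∈ᵇc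
    ... | true  = refl
    ... | false rewrite <ᵇ-true a<b | <ᵇ-irrefl b | <ᵇ-true (<-trans a<b (n<1+n b)) | <ᵇ-true (n<1+n b)
                      | countBelow-none {b} c b≤c | countBelow-none {b} d b≤d
                      | countBelow-none {suc b} c (≤-∉⇒< c b≤c b∈ᵇc)
      = refl

    patternOf-after : ∀ v → b < v → patternOf (a ∷ c) (b ∷ d) v ≡ patternOf c d v
    patternOf-after v b<v
      rewrite ≡ᵇ-false {a} {v} (λ e → <-irrefl e (≤-<-trans a≤b b<v))
            | <ᵇ-true (≤-<-trans a≤b b<v) | <ᵇ-true b<v
            | <ᵇ-true (<-trans (≤-<-trans a≤b b<v) (n<1+n v)) | <ᵇ-true (<-trans b<v (n<1+n v))
      = refl

  Alternates⇒pattern : ∀ s c d → Interlaced s c d → Alternates s c d → ∀ v → s < v → v < n → patternOf c d v ≡ true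
  Alternates⇒pattern s []      []      _               asc v s<v v<n = trans (patternOf-[] v) (asc v s<v v<n v<n)
  Alternates⇒pattern s (a ∷ c) (b ∷ d) (s≤a , a≤b , r) (asc , desc , alt) v s<v v<n = byPosition
    where
    open FirstInterval a b c d a≤b (Interlaced-lowerᶜ c d r) (Interlaced-lowerᵈ c d r)
    byPosition : patternOf (a ∷ c) (b ∷ d) v ≡ true
    byPosition with <-cmp v a
    ... | tri< v<a _ _  = trans (patternOf-before v v<a) (asc v s<v v<a v<n)
    ... | tri≈ _ refl _ = patternOf-start
    ... | tri> _ _ a<v with <-cmp v b
    ...   | tri< v<b _ _  = trans (patternOf-inside v a<v v<b) (cong not (desc v a<v v<b v<n))
    ...   | tri≈ _ refl _ = patternOf-end a<v
    ...   | tri> _ _ b<v  = trans (patternOf-after v b<v) (Alternates⇒pattern b c d r alt v b<v v<n)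

  pattern⇒Alternates : ∀ s c d → Interlaced s c d → (∀ v → s < v → v < n → patternOf c d v ≡ true) → Alternates s c d
  pattern⇒Alternates s []      []      _               h v s<v v<j v<n = trans (sym (patternOf-[] v)) (h v s<v v<n)
  pattern⇒Alternates s (a ∷ c) (b ∷ d) (s≤a , a≤b , r) h = asc , desc , pattern⇒Alternates b c d r h′
    where
    open FirstInterval a b c d a≤b (Interlaced-lowerᶜ c d r) (Interlaced-lowerᵈ c d r)
    asc : AscendsOn s a
    asc v s<v v<a v<n = trans (sym (patternOf-before v v<a)) (h v s<v v<n)
    desc : DescendsOn a b
    desc v a<v v<b v<n =
      not-injective (trans (sym (patternOf-inside v a<v v<b)) (h v (≤-<-trans s≤a a<v) v<n))
    h′ : ∀ v → b < v → v < n → patternOf c d v ≡ true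
    h′ v b<v v<n = trans (sym (patternOf-after v b<v)) (h v (≤-<-trans (≤-trans s≤a a≤b) b<v) v<n)

-- Rebuilding the rank sequences from (T, E)

runs : (ℕ → ℕ) → ℕ → ℕ → List ℕ
runs m zero    p = []
runs m (suc k) p = replicate (m p) p ++ runs m k (suc p)

module _ (m : ℕ → ℕ) where

  private
    replicate-++-All : ∀ {P : ℕ → Set} {p} k {l} → P p → All P l → All P (replicate k p ++ l)
    replicate-++-All zero    _  ps = ps
    replicate-++-All (suc k) pp ps = pp ∷ replicate-++-All k pp ps

  runs-bounds : ∀ k p → All (λ r → p ≤ r × r < p + k) (runs m k p)
  runs-bounds zero    p = []
  runs-bounds (suc k) p = replicate-++-All (m p) (≤-refl , m<m+n p (s≤s z≤n))
    (All.map (λ {r} (p<r , r<) → <⇒≤ p<r , subst (r <_) (sym (+-suc p k)) r<) (runs-bounds k (suc p)))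

  runs-sorted : ∀ k p → Linked _≤_ (runs m k p)
  runs-sorted zero    p = []
  runs-sorted (suc k) p = go (m p)
    where
    go : ∀ j → Linked _≤_ (replicate j p ++ runs m k (suc p))
    go zero    = runs-sorted k (suc p)
    go (suc j) = linked-∷ (replicate-++-All j ≤-refl (All.map (<⇒≤ ∘ proj₁) (runs-bounds k (suc p)))) (go j)

  runs-strict : (∀ r → m r ≤ 1) → ∀ k p → Linked _<_ (runs m k p)
  runs-strict m≤1 zero    p = []
  runs-strict m≤1 (suc k) p with m p | m≤1 p
  ... | zero  | _       = runs-strict m≤1 k (suc p)
  ... | suc zero | _    = linked-∷ (All.map proj₁ (runs-bounds k (suc p))) (runs-strict m≤1 k (suc p))
  ... | suc (suc _) | s≤s ()

  multiplicity-runs : ∀ k p q → p ≤ q → (∀ r → p + k ≤ r → m r ≡ 0) → multiplicity q (runs m k p) ≡ m q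
  multiplicity-runs zero    p q p≤q vanish = sym (vanish q (subst (_≤ q) (sym (+-identityʳ p)) p≤q))
  multiplicity-runs (suc k) p q p≤q vanish with m≤n⇒m<n∨m≡n p≤q
  ... | inj₂ refl rewrite multiplicity-replicate-++ (m p) p p (runs m k (suc p)) | ≡ᵇ-refl p
                        | multiplicity-none _ (All.map proj₁ (runs-bounds k (suc p)))
    = trans (+-identityʳ _) (*-identityʳ (m p))
  ... | inj₁ p<q rewrite multiplicity-replicate-++ (m p) p q (runs m k (suc p)) | ≡ᵇ-false (λ p≡q → <-irrefl p≡q p<q)
                       | *-zeroʳ (m p)
    = multiplicity-runs k (suc p) q p<q (λ r le → vanish r (subst (_≤ r) (sym (+-suc p k)) le))

module Reconstruction (n : ℕ) (t x : ℕ → Bool) where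

  -- The number of i with dᵢ = p: the interval through a covered p ends there if p+1 is
  -- uncovered or p ∈ c, and p ∈ c followed by an uncovered p+1 adds an empty interval (p, p].
  ends : ℕ → ℕ
  ends p = 𝟙 (t p ∧ not (x (suc p))) + 𝟙 (x p ∧ (t p ∨ not (x (suc p))))

  cs ds : List ℕ
  cs = runs (𝟙 ∘ t) (suc n) 0
  ds = runs ends (suc n) 0

  module Properties (t-beyond : ∀ q → n ≤ q → t q ≡ false) (x-zero : x 0 ≡ false)
                    (x-beyond : ∀ q → n < q → x q ≡ false)
                    (x-closed : ∀ q → x (suc q) ≡ true → t q ≡ false → x q ≡ true) where

    multiplicity-cs : ∀ q → multiplicity q cs ≡ 𝟙 (t q)
    multiplicity-cs q = multiplicity-runs (𝟙 ∘ t) (suc n) 0 q z≤n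
      (λ r n<r → cong 𝟙 (t-beyond r (<⇒≤ n<r)))

    multiplicity-ds : ∀ q → multiplicity q ds ≡ ends q
    multiplicity-ds q = multiplicity-runs ends (suc n) 0 q z≤n vanish
      where
      vanish : ∀ r → suc n ≤ r → ends r ≡ 0
      vanish r n<r rewrite t-beyond r (<⇒≤ n<r) | x-beyond r n<r = refl

    ends-balance : ∀ q → 𝟙 (x q) + 𝟙 (t q) ≡ ends q + 𝟙 (x (suc q))
    ends-balance q with x q in xq | t q in tq | x (suc q) in xs
    ... | true  | true  | true  = refl
    ... | true  | true  | false = refl
    ... | true  | false | true  = refl
    ... | true  | false | false = refl
    ... | false | true  | true  = refl
    ... | false | true  | false = refl
    ... | false | false | true  = ⊥-elim (false≢true (trans (sym xq) (x-closed q xs tq)))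
    ... | false | false | false = refl

    countBelow-cs : ∀ q → countBelow q cs ≡ countBelow q ds + 𝟙 (x q)
    countBelow-cs zero    rewrite countBelow-zero cs | countBelow-zero ds | x-zero = refl
    countBelow-cs (suc q) = begin
      countBelow (suc q) cs                               ≡⟨ countBelow-suc q cs ⟩
      countBelow q cs + multiplicity q cs                 ≡⟨ cong₂ _+_ (countBelow-cs q) (multiplicity-cs q) ⟩
      countBelow q ds + 𝟙 (x q) + 𝟙 (t q)                 ≡⟨ +-assoc (countBelow q ds) _ _ ⟩
      countBelow q ds + (𝟙 (x q) + 𝟙 (t q))               ≡⟨ cong (countBelow q ds +_) (ends-balance q) ⟩
      countBelow q ds + (ends q + 𝟙 (x (suc q)))          ≡⟨ +-assoc (countBelow q ds) _ _ ⟨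
      countBelow q ds + ends q + 𝟙 (x (suc q))
        ≡⟨ cong (λ e → countBelow q ds + e + 𝟙 (x (suc q))) (multiplicity-ds q) ⟨
      countBelow q ds + multiplicity q ds + 𝟙 (x (suc q)) ≡⟨ cong (_+ 𝟙 (x (suc q))) (countBelow-suc q ds) ⟨
      countBelow (suc q) ds + 𝟙 (x (suc q))               ∎
      where open ≡-Reasoning

    cs-strict : Linked _<_ cs
    cs-strict = runs-strict (𝟙 ∘ t) (𝟙≤1 ∘ t) (suc n) 0

    ds-sorted : Linked _≤_ ds
    ds-sorted = runs-sorted ends (suc n) 0

    cs≤n : All (_≤ n) cs
    cs≤n = All.map (≤-pred ∘ proj₂) (runs-bounds (𝟙 ∘ t) (suc n) 0)

    ds≤n : All (_≤ n) ds
    ds≤n = All.map (≤-pred ∘ proj₂) (runs-bounds ends (suc n) 0)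

    length-cs : length cs ≡ length ds
    length-cs = begin
      length cs                             ≡⟨ countBelow-all cs (All.map s≤s cs≤n) ⟨
      countBelow (suc n) cs                 ≡⟨ countBelow-cs (suc n) ⟩
      countBelow (suc n) ds + 𝟙 (x (suc n)) ≡⟨ cong (λ b → countBelow (suc n) ds + 𝟙 b) (x-beyond (suc n) ≤-refl) ⟩
      countBelow (suc n) ds + 0             ≡⟨ +-identityʳ _ ⟩
      countBelow (suc n) ds                 ≡⟨ countBelow-all ds (All.map s≤s ds≤n) ⟩
      length ds                             ∎
      where open ≡-Reasoning

    cs-ds-Interlaced : Interlaced 0 cs ds
    cs-ds-Interlaced = Interlaced-by-counts 0 cs ds cs-strict ds-sorted (All.map (λ _ → z≤n) cs≤n) length-cs
      (λ q → subst (countBelow q ds ≤_) (sym (countBelow-cs q)) (m≤m+n _ _))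
      (λ q → subst (_≤ suc (countBelow q ds)) (sym (countBelow-cs q))
                   (subst (countBelow q ds + 𝟙 (x q) ≤_) (+-comm (countBelow q ds) 1)
                          (+-monoʳ-≤ (countBelow q ds) (𝟙≤1 (x q)))))

    covered-cs-ds : ∀ q → covered cs ds q ≡ x q
    covered-cs-ds q rewrite countBelow-cs q = <ᵇ-+𝟙 (countBelow q ds) (x q)

    ∈ᵇ-cs : ∀ q → (q ∈ᵇ cs) ≡ t q
    ∈ᵇ-cs q = 𝟙-injective (trans (sym (multiplicity-strict q cs cs-strict)) (multiplicity-cs q))

    countBelow-ds : ∀ {s} c d → Interlaced s c d → (∀ q → x q ≡ covered c d q) → (k : ℕ → ℕ) →
                    (∀ q → k q + countBelow q cs ≡ countBelow q c) → ∀ q → k q + countBelow q ds ≡ countBelow q d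
    countBelow-ds c d il x≡ k counts q = +-cancelʳ-≡ (𝟙 (x q)) _ _ (begin
      k q + countBelow q ds + 𝟙 (x q)             ≡⟨ +-assoc (k q) _ _ ⟩
      k q + (countBelow q ds + 𝟙 (x q))           ≡⟨ cong (k q +_) (countBelow-cs q) ⟨
      k q + countBelow q cs                       ≡⟨ counts q ⟩
      countBelow q c                              ≡⟨ countBelow-Interlaced c d il q ⟩
      countBelow q d + 𝟙 (covered c d q)          ≡⟨ cong (λ b → countBelow q d + 𝟙 b) (x≡ q) ⟨
      countBelow q d + 𝟙 (x q)                    ∎)
      where open ≡-Reasoning

-- The letters of u(M, E)

-- The letter of u(M, E) at v is 𝐛 iff isB [λ ascends weakly at M_v] [v ∈ E] [v+1 ∈ E].
isB : Bool → Bool → Bool → Bool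
isB a xv xs = if a then xs else not xv

-- A point v ∈ C can be dropped from C: afterwards v is still covered when v+1 is, and the
-- IncDec condition still holds at v.
Removable : Bool → Bool → Bool → Set
Removable xv xs a = (xs ≡ true → xv ≡ true) × patternAt false xv xs a ≡ true

isB-closed : ∀ a xv xs → xs ≡ true → isB a xv xs ≡ false → xv ≡ true
isB-closed true  _     _     refl ()
isB-closed false true  _     _    _  = refl
isB-closed false false _     _    ()

isB-pattern : ∀ a xv xs → patternAt (isB a xv xs) xv xs a ≡ true
isB-pattern true  true  true  = refl
isB-pattern true  true  false = refl
isB-pattern true  false true  = refl
isB-pattern true  false false = refl
isB-pattern false true  true  = refl
isB-pattern false true  false = refl
isB-pattern false false true  = refl
isB-pattern false false false = refl

isB-irremovable : ∀ a xv xs → isB a xv xs ≡ true → ¬ Removable xv xs a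
isB-irremovable true  true  true  _ (_ , ())
isB-irremovable true  false true  _ (closed , _) = false≢true (closed refl)
isB-irremovable false false true  _ (_ , ())
isB-irremovable false false false _ (_ , ())

isB-characterisation : ∀ a xv xs t → (xs ≡ true → t ≡ false → xv ≡ true) → patternAt t xv xs a ≡ true →
                       (t ≡ true → ¬ Removable xv xs a) → isB a xv xs ≡ t
isB-characterisation true  true  true  true  _      _  _   = refl
isB-characterisation true  true  true  false _      () _
isB-characterisation true  false true  true  _      _  _   = refl
isB-characterisation true  false true  false closed _  _   = ⊥-elim (false≢true (closed refl refl))
isB-characterisation true  true  false true  _      _  irr = ⊥-elim (irr refl ((λ ()) , refl))
isB-characterisation true  true  false false _      _  _   = refl
isB-characterisation true  false false true  _      _  irr = ⊥-elim (irr refl ((λ ()) , refl))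
isB-characterisation true  false false false _      _  _   = refl
isB-characterisation false true  true  true  _      _  irr = ⊥-elim (irr refl ((λ _ → refl) , refl))
isB-characterisation false true  true  false _      _  _   = refl
isB-characterisation false true  false true  _      _  irr = ⊥-elim (irr refl ((λ _ → refl) , refl))
isB-characterisation false true  false false _      _  _   = refl
isB-characterisation false false true  true  _      _  _   = refl
isB-characterisation false false true  false _      () _
isB-characterisation false false false true  _      _  _   = refl
isB-characterisation false false false false _      () _

letter : Bool → Letter
letter b = if b then 𝐛 else 𝐚

letter-injective : ∀ {a b} → letter a ≡ letter b → a ≡ b
letter-injective {true}  {true}  _ = refl
letter-injective {false} {false} _ = refl

-- ℕ-indexed access to vectors: atℕ clamps to the last entry, bitAt is false beyond the end.
atℕ : ∀ {A : Set} {k} → Vec A (suc k) → ℕ → A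
atℕ (x ∷ [])    _       = x
atℕ (x ∷ y ∷ v) zero    = x
atℕ (x ∷ y ∷ v) (suc i) = atℕ (y ∷ v) i

atℕ-toℕ : ∀ {A : Set} {k} (V : Vec A (suc k)) (i : Fin (suc k)) → atℕ V (toℕ i) ≡ lookup V i
atℕ-toℕ (x ∷ [])    zero    = refl
atℕ-toℕ (x ∷ y ∷ v) zero    = refl
atℕ-toℕ (x ∷ y ∷ v) (suc i) = atℕ-toℕ (y ∷ v) i

atℕ-∈ : ∀ {A : Set} {k} (V : Vec A (suc k)) i → atℕ V i ∈ toList V
atℕ-∈ (x ∷ [])    _       = here refl
atℕ-∈ (x ∷ y ∷ v) zero    = here refl
atℕ-∈ (x ∷ y ∷ v) (suc i) = there (atℕ-∈ (y ∷ v) i)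

∈⇒atℕ : ∀ {A : Set} {k} (V : Vec A (suc k)) {z} → z ∈ toList V → Σ ℕ λ i → i ≤ k × z ≡ atℕ V i
∈⇒atℕ (x ∷ [])    (here z≡x)  = 0 , z≤n , z≡x
∈⇒atℕ (x ∷ y ∷ v) (here z≡x)  = 0 , z≤n , z≡x
∈⇒atℕ (x ∷ y ∷ v) (there z∈v) with ∈⇒atℕ (y ∷ v) z∈v
... | i , i≤k , z≡ = suc i , s≤s i≤k , z≡

bitAt : ∀ {k} → Vec Bool k → ℕ → Bool
bitAt []      _       = false
bitAt (b ∷ v) zero    = b
bitAt (b ∷ v) (suc i) = bitAt v i

bitAt-toℕ : ∀ {k} (V : Vec Bool k) (i : Fin k) → bitAt V (toℕ i) ≡ lookup V i
bitAt-toℕ (b ∷ v) zero    = refl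
bitAt-toℕ (b ∷ v) (suc i) = bitAt-toℕ v i

bitAt⇒index : ∀ {k} (V : Vec Bool k) q → bitAt V q ≡ true → Σ (Fin k) λ r → toℕ r ≡ q × lookup V r ≡ true
bitAt⇒index (b ∷ v) zero    e = zero , refl , e
bitAt⇒index (b ∷ v) (suc q) e with bitAt⇒index v q e
... | r , refl , e′ = suc r , refl , e′

index⇒bitAt : ∀ {k} (V : Vec Bool k) q → (Σ (Fin k) λ r → toℕ r ≡ q × lookup V r ≡ true) → bitAt V q ≡ true
index⇒bitAt V q (r , refl , e) = trans (bitAt-toℕ V r) e

bitAt-beyond : ∀ {k} (V : Vec Bool k) q → k ≤ q → bitAt V q ≡ false
bitAt-beyond []      q       _         = refl
bitAt-beyond (b ∷ v) (suc q) (s≤s k≤q) = bitAt-beyond v q k≤q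

bitAt-tabulate : ∀ k (g : ℕ → Bool) q → q < k → bitAt (tabulate {n = k} (g ∘ toℕ)) q ≡ g q
bitAt-tabulate (suc k) g zero    _         = refl
bitAt-tabulate (suc k) g (suc q) (s≤s q<k) = bitAt-tabulate k (g ∘ suc) q q<k

∣∣-bitAt : ∀ {k} (V : Vec Bool k) → ∣ V ∣ ≡ sumTo k (𝟙 ∘ bitAt V)
∣∣-bitAt []          = refl
∣∣-bitAt (true ∷ v)  = cong suc (∣∣-bitAt v)
∣∣-bitAt (false ∷ v) = ∣∣-bitAt v

∣tabulate∣ : ∀ k (g : ℕ → Bool) → ∣ tabulate {n = k} (g ∘ toℕ) ∣ ≡ sumTo k (𝟙 ∘ g)
∣tabulate∣ zero    g = refl
∣tabulate∣ (suc k) g with g 0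
... | true  = cong suc (∣tabulate∣ k (g ∘ suc))
... | false = ∣tabulate∣ k (g ∘ suc)

-- A subset E of {1,…,n}, stored as a Subset n whose index i stands for i+1.
inE : ∀ {k} → Vec Bool k → ℕ → Bool
inE E zero    = false
inE E (suc i) = bitAt E i

inE-beyond : ∀ {k} (E : Vec Bool k) q → k < q → inE E q ≡ false
inE-beyond E (suc q) (s≤s k≤q) = bitAt-beyond E q k≤q

-- extra S T M of the definitions is extraOf S T (lookup M ∘ inject₁).
module _ {A : Set} where

  extraStep : ∀ {k} → Subset k → Subset k → (Fin k → A) → Fin k → List A → List A
  extraStep S T f r acc = if lookup T r then (if lookup S r then acc else f r ∷ acc) else acc

  extraOf : ∀ {k} → Subset k → Subset k → (Fin k → A) → List A
  extraOf S T f = foldr (extraStep S T f) [] (allFin _)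

  extraOf-∷ : ∀ {k} s b (S T : Subset k) f →
              extraOf (s ∷ S) (b ∷ T) f ≡
              (if b then (if s then extraOf S T (f ∘ suc) else f zero ∷ extraOf S T (f ∘ suc))
                    else extraOf S T (f ∘ suc))
  extraOf-∷ s b S T f = cong (λ acc → if b then (if s then acc else f zero ∷ acc) else acc)
    (trans (cong (foldr (extraStep (s ∷ S) (b ∷ T) f) []) (sym (map-tabulate id suc)))
           (foldr-map (extraStep (s ∷ S) (b ∷ T) f) suc [] (allFin _)))

  extraOf-self : ∀ {k} (S : Subset k) f → extraOf S S f ≡ []
  extraOf-self []          f = refl
  extraOf-self (true ∷ S)  f = trans (extraOf-∷ true true S S f) (extraOf-self S (f ∘ suc))
  extraOf-self (false ∷ S) f = trans (extraOf-∷ false false S S f) (extraOf-self S (f ∘ suc))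

  extraOf-minus : ∀ {k} (T : Subset k) r f → lookup T r ≡ true → extraOf (T - r) T f ≡ f r ∷ []
  extraOf-minus (b ∷ T) zero    f refl = begin
    extraOf ((true ∷ T) - zero) (true ∷ T) f ≡⟨ cong (λ S → extraOf (false ∷ S) (true ∷ T) f) (p─⊥≡p T) ⟩
    extraOf (false ∷ T) (true ∷ T) f         ≡⟨ extraOf-∷ false true T T f ⟩
    f zero ∷ extraOf T T (f ∘ suc)           ≡⟨ cong (f zero ∷_) (extraOf-self T (f ∘ suc)) ⟩
    f zero ∷ []                              ∎
    where open ≡-Reasoning
  extraOf-minus (b ∷ T) (suc r) f e =
    trans (extraOf-∷ b b (T - r) T f) (trans (same b) (extraOf-minus T r (f ∘ suc) e))
    where
    same : ∀ b → (if b then (if b then extraOf (T - r) T (f ∘ suc) else f zero ∷ extraOf (T - r) T (f ∘ suc))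
                         else extraOf (T - r) T (f ∘ suc)) ≡ extraOf (T - r) T (f ∘ suc)
    same true  = refl
    same false = refl

bitAt-minus-self : ∀ {k} (S : Subset k) r → bitAt (S - r) (toℕ r) ≡ false
bitAt-minus-self (b ∷ S) zero    = refl
bitAt-minus-self (b ∷ S) (suc r) = bitAt-minus-self S r

bitAt-minus-other : ∀ {k} (S : Subset k) r q → toℕ r ≢ q → bitAt (S - r) q ≡ bitAt S q
bitAt-minus-other (b ∷ S) zero    zero    r≢q = ⊥-elim (r≢q refl)
bitAt-minus-other (b ∷ S) zero    (suc q) _   = cong (λ S′ → bitAt S′ q) (p─⊥≡p S)
bitAt-minus-other (b ∷ S) (suc r) zero    _   = refl
bitAt-minus-other (b ∷ S) (suc r) (suc q) r≢q = bitAt-minus-other S r q (r≢q ∘ cong suc)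

bitAt-minus-𝟙 : ∀ {k} (S : Subset k) r → lookup S r ≡ true →
                ∀ q → 𝟙 (toℕ r ≡ᵇ q) + 𝟙 (bitAt (S - r) q) ≡ 𝟙 (bitAt S q)
bitAt-minus-𝟙 S r r∈S q with toℕ r ≟ q
... | yes refl rewrite ≡ᵇ-refl (toℕ r) | bitAt-minus-self S r | bitAt-toℕ S r | r∈S = refl
... | no  r≢q  rewrite ≡ᵇ-false r≢q | bitAt-minus-other S r q r≢q = refl

-- The bijection on a maximal chain

module Main (P : FinPoset) (n : ℕ) (G : PosetDefs.Graded P n)
            (lab : FinPoset.Carrier P → FinPoset.Carrier P → ℕ) where

  open PosetDefs P renaming (_≤_ to _≼_; _<_ to _≺_)
  open Graded G
  open Setup n G lab
  private module ≼ = IsPartialOrder isPartialOrder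

  ranks : List Carrier → List ℕ
  ranks = map rank

  E-of : List Carrier → List Carrier → Subset n
  E-of C D = tabulate (covered (ranks C) (ranks D) ∘ suc ∘ toℕ)

  module Canonical (S E : Subset n) = Reconstruction n (bitAt S) (inE E)

  canonical : Vec Carrier (suc n) → Subset n → Subset n → Triple
  canonical M S E = map (atℕ M) (Canonical.cs S E) , map (atℕ M) (Canonical.ds S E) , M

  countBelow-insertR : ∀ q z L → countBelow q (ranks (insertR z L)) ≡ 𝟙 (rank z <ᵇ q) + countBelow q (ranks L)
  countBelow-insertR q z []       = refl
  countBelow-insertR q z (y ∷ ys) with rank z ≤ᵇ rank y
  ... | true  = refl
  ... | false rewrite countBelow-insertR q z ys = +-left-comm (𝟙 (rank y <ᵇ q)) (𝟙 (rank z <ᵇ q)) _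

  countBelow-foldr-insertR : ∀ q L ex →
    countBelow q (ranks (foldr insertR L ex)) ≡ countBelow q (ranks ex) + countBelow q (ranks L)
  countBelow-foldr-insertR q L []       = refl
  countBelow-foldr-insertR q L (z ∷ ex)
    rewrite countBelow-insertR q z (foldr insertR L ex) | countBelow-foldr-insertR q L ex =
    sym (+-assoc (𝟙 (rank z <ᵇ q)) _ _)

  covered-foldr-insertR : ∀ C D ex q →
    covered (ranks (foldr insertR C ex)) (ranks (foldr insertR D ex)) q ≡ covered (ranks C) (ranks D) q
  covered-foldr-insertR C D ex q rewrite countBelow-foldr-insertR q C ex | countBelow-foldr-insertR q D ex =
    <ᵇ-+-cancelˡ (countBelow q (ranks ex)) _ _

  All-insertR : ∀ {Q : Carrier → Set} z L → Q z → All Q L → All Q (insertR z L)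
  All-insertR z []       qz []         = qz ∷ []
  All-insertR z (y ∷ ys) qz (qy ∷ qys) with rank z ≤ᵇ rank y
  ... | true  = qz ∷ qy ∷ qys
  ... | false = qy ∷ All-insertR z ys qz qys

  insertR-sorted : ∀ z L → Linked _≤_ (ranks L) → Linked _≤_ (ranks (insertR z L))
  insertR-sorted z []       _      = [-]
  insertR-sorted z (y ∷ ys) sorted with rank z ≤ᵇ rank y in z≤ᵇy
  ... | true  = proj₂ (≤⇔≤ᵇ (rank z) (rank y)) z≤ᵇy ∷ sorted
  ... | false = linked-∷ (AllP.map⁺ (All-insertR z ys y≤z (AllP.map⁻ (head-bounds ≤-trans sorted))))
                         (insertR-sorted z ys (Linked.tail sorted))
    where
    y≤z : rank y ≤ rank z
    y≤z = <⇒≤ (proj₂ (>⇔≤ᵇ (rank z) (rank y)) z≤ᵇy)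

  φ-minus : ∀ (T : Subset n) r C D M → lookup T r ≡ true →
            φ (T - r) T (C , D , M) ≡ (insertR (lookup M (inject₁ r)) C , insertR (lookup M (inject₁ r)) D , M)
  φ-minus T r C D M Tr =
    cong (λ ex → foldr insertR C ex , foldr insertR D ex , M) (extraOf-minus T r (lookup M ∘ inject₁) Tr)

  letterV-isB : ∀ a inE? prev → letterV (if a then 𝐚 else 𝐛) inE? prev ≡ letter (isB a prev inE?)
  letterV-isB true  _ _     = refl
  letterV-isB false _ true  = refl
  letterV-isB false _ false = refl

  prevIn-inE : ∀ (E : Subset n) i → prevIn E i ≡ inE E (toℕ i)
  prevIn-inE E zero    = refl
  prevIn-inE E (suc j) = trans (sym (bitAt-toℕ E (inject₁ j))) (cong (bitAt E) (toℕ-inject₁ j))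

  module OnChain (M : Vec Carrier (suc n)) (mc : MaxChain M) where

    M[_] : ℕ → Carrier
    M[_] = atℕ M

    OnM : Carrier → Set
    OnM x = x ∈ toList M

    M[inject₁] : ∀ (k : Fin n) → lookup M (inject₁ k) ≡ M[ toℕ k ]
    M[inject₁] k = trans (sym (atℕ-toℕ M (inject₁ k))) (cong M[_] (toℕ-inject₁ k))

    M[suc] : ∀ (k : Fin n) → lookup M (suc k) ≡ M[ suc (toℕ k) ]
    M[suc] k = sym (atℕ-toℕ M (suc k))

    M-covers : ∀ i → i < n → M[ i ] ⋖ M[ suc i ]
    M-covers i i<n = subst₂ _⋖_ (trans (M[inject₁] k) (cong M[_] (toℕ-fromℕ< i<n)))
                                (trans (M[suc] k) (cong (M[_] ∘ suc) (toℕ-fromℕ< i<n)))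
                                (proj₂ (proj₂ mc) k)
      where k = fromℕ< i<n

    segment : ℕ → ℕ → List Carrier
    segment i zero    = M[ i ] ∷ []
    segment i (suc m) = M[ i ] ∷ segment (suc i) m

    segment-saturated : ∀ i m → i + m ≤ n → Linked _⋖_ (segment i m)
    segment-saturated i zero          _ = [-]
    segment-saturated i (suc zero)    p = M-covers i (subst (_≤ n) (+-comm i 1) p) ∷ [-]
    segment-saturated i (suc (suc m)) p =
      M-covers i (≤-trans (s≤s (m≤m+n i (suc m))) i+m<n) ∷ segment-saturated (suc i) (suc m) i+m<n
      where i+m<n = subst (_≤ n) (+-suc i (suc m)) p

    segment-last : ∀ i m → last (segment i m) ≡ just M[ i + m ]
    segment-last i zero          = cong (just ∘ M[_]) (sym (+-identityʳ i))
    segment-last i (suc zero)    = cong (just ∘ M[_]) (+-comm 1 i)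
    segment-last i (suc (suc m)) = trans (segment-last (suc i) (suc m)) (cong (just ∘ M[_]) (sym (+-suc i (suc m))))

    segment-length : ∀ i m → length (segment i m) ≡ suc m
    segment-length i zero    = refl
    segment-length i (suc m) = cong suc (segment-length (suc i) m)

    segment-head : ∀ m → head (segment 0 m) ≡ just bot
    segment-head zero    = cong just (trans (atℕ-toℕ M zero) (proj₁ mc))
    segment-head (suc _) = cong just (trans (atℕ-toℕ M zero) (proj₁ mc))

    rank-M : ∀ k → k ≤ n → rank M[ k ] ≡ k
    rank-M k k≤n = suc-injective (trans
      (sym (rank-len M[ k ] (segment 0 k) (segment-saturated 0 k k≤n , segment-head k , segment-last 0 k)))
      (segment-length 0 k))

    M-mono : ∀ i j → i ≤ j → j ≤ n → M[ i ] ≼ M[ j ]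
    M-mono i j i≤j j≤n with m≤n⇒m<n∨m≡n i≤j
    ... | inj₂ refl = ≼.refl
    ... | inj₁ i<j with j
    ...   | suc j′ = ≼.trans (M-mono i j′ (≤-pred i<j) (≤-trans (n≤1+n j′) j≤n)) (proj₁ (proj₁ (M-covers j′ j≤n)))

    M-injective : ∀ i j → i ≤ n → j ≤ n → M[ i ] ≡ M[ j ] → i ≡ j
    M-injective i j i≤n j≤n e = trans (sym (rank-M i i≤n)) (trans (cong rank e) (rank-M j j≤n))

    M-strict : ∀ i j → i < j → j ≤ n → M[ i ] ≺ M[ j ]
    M-strict i j i<j j≤n = M-mono i j (<⇒≤ i<j) j≤n ,
      λ e → <-irrefl (M-injective i j (≤-trans (<⇒≤ i<j) j≤n) j≤n e) i<j

    OnM⇒ : ∀ {z} → OnM z → z ≡ M[ rank z ] × rank z ≤ n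
    OnM⇒ z∈M with ∈⇒atℕ M z∈M
    ... | i , i≤n , refl rewrite rank-M i i≤n = refl , i≤n

    rank-mono : ∀ {x y} → OnM x → OnM y → x ≼ y → rank x ≤ rank y
    rank-mono {x} {y} x∈M y∈M x≼y with OnM⇒ x∈M | OnM⇒ y∈M | ≤-total (rank x) (rank y)
    ... | _        | _        | inj₁ rx≤ry = rx≤ry
    ... | x≡ , x≤n | y≡ , y≤n | inj₂ ry≤rx = ≤-reflexive (M-injective _ _ x≤n y≤n (trans (sym x≡) (trans x≡y y≡)))
      where
      x≡y : x ≡ y
      x≡y = ≼.antisym x≼y (subst₂ _≼_ (sym y≡) (sym x≡) (M-mono _ _ ry≤rx x≤n))

    rank-strict : ∀ {x y} → OnM x → OnM y → x ≺ y → rank x < rank y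
    rank-strict x∈M y∈M (x≼y , x≢y) = ≤∧≢⇒< (rank-mono x∈M y∈M x≼y)
      λ e → x≢y (trans (proj₁ (OnM⇒ x∈M)) (trans (cong M[_] e) (sym (proj₁ (OnM⇒ y∈M)))))

    stepLabel : ℕ → ℕ
    stepLabel k = lab M[ k ] M[ suc k ]

    -- ascent v compares the labels of the two steps at M[v]; position 0 counts as an ascent,
    -- matching the first letter 𝐚 of u(M).
    ascent : ℕ → Bool
    ascent zero    = true
    ascent (suc k) = stepLabel k ≤ᵇ stepLabel (suc k)

    open Pattern n ascent public

    stepLab-M : ∀ (k : Fin n) → stepLab M k ≡ stepLabel (toℕ k)
    stepLab-M k = cong₂ lab (M[inject₁] k) (M[suc] k)

    ascent-steps : ∀ v (k k′ : Fin n) → toℕ k ≡ v → toℕ k′ ≡ suc v → ascent (suc v) ≡ (stepLab M k ≤ᵇ stepLab M k′)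
    ascent-steps v k k′ refl e rewrite stepLab-M k | stepLab-M k′ | e = refl

    -- IncAlong and DecAlong both have the shape  ∀ consecutive steps k k′ → R (stepLab k) (stepLab k′),
    -- with R x y ⇔ (x ≤ᵇ y) ≡ b for b = true resp. false.
    module Along (R : ℕ → ℕ → Set) (b : Bool) (R⇔ : ∀ x y → (R x y → (x ≤ᵇ y) ≡ b) × ((x ≤ᵇ y) ≡ b → R x y))
                 (i j : ℕ) where

      AlongSteps : Set
      AlongSteps = ∀ (k k′ : Fin n) → toℕ k′ ≡ suc (toℕ k) → i ≤ toℕ k → toℕ k′ < j → R (stepLab M k) (stepLab M k′)

      AlongPositions : Set
      AlongPositions = ∀ v → i < v → v < j → v < n → ascent v ≡ b

      steps⇒positions : AlongSteps → AlongPositions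
      steps⇒positions along (suc w) i<v v<j v<n =
        trans (ascent-steps w k k′ (toℕ-fromℕ< w<n) (toℕ-fromℕ< v<n))
              (proj₁ (R⇔ _ _) (along k k′ k′≡ (subst (i ≤_) (sym (toℕ-fromℕ< w<n)) (≤-pred i<v))
                                              (subst (_< j) (sym (toℕ-fromℕ< v<n)) v<j)))
        where
        w<n = <-trans (n<1+n w) v<n
        k   = fromℕ< w<n
        k′  = fromℕ< v<n
        k′≡ : toℕ k′ ≡ suc (toℕ k)
        k′≡ = trans (toℕ-fromℕ< v<n) (cong suc (sym (toℕ-fromℕ< w<n)))

      positions⇒steps : AlongPositions → AlongSteps
      positions⇒steps along k k′ e i≤k k′<j = proj₂ (R⇔ _ _)
        (trans (sym (ascent-steps (toℕ k) k k′ refl e))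
               (along (suc (toℕ k)) (s≤s i≤k) (subst (_< j) e k′<j) (subst (_< n) e (toℕ<n k′))))

    module Inc = Along _≤_ true ≤⇔≤ᵇ
    module Dec = Along (λ x y → y < x) false >⇔≤ᵇ

    IncDecPattern⇒Alternates : ∀ s C D → IncDecPattern M s C D → Alternates s (ranks C) (ranks D)
    IncDecPattern⇒Alternates s []      []      inc             = Inc.steps⇒positions s n inc
    IncDecPattern⇒Alternates s (c ∷ C) (d ∷ D) (inc , dec , r) =
      Inc.steps⇒positions s (rank c) inc , Dec.steps⇒positions (rank c) (rank d) dec ,
      IncDecPattern⇒Alternates (rank d) C D r

    Alternates⇒IncDecPattern : ∀ s C D → Alternates s (ranks C) (ranks D) → IncDecPattern M s C D
    Alternates⇒IncDecPattern s []      []      asc              = Inc.positions⇒steps s n asc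
    Alternates⇒IncDecPattern s (c ∷ C) (d ∷ D) (asc , desc , r) =
      Inc.positions⇒steps s (rank c) asc , Dec.positions⇒steps (rank c) (rank d) desc ,
      Alternates⇒IncDecPattern (rank d) C D r

    ranks-map-M : ∀ c → All (_≤ n) c → ranks (map M[_] c) ≡ c
    ranks-map-M []      []         = refl
    ranks-map-M (a ∷ c) (a≤n ∷ ps) = cong₂ _∷_ (rank-M a a≤n) (ranks-map-M c ps)

    map-M-ranks : ∀ C → All OnM C → map M[_] (ranks C) ≡ C
    map-M-ranks []      []           = refl
    map-M-ranks (x ∷ C) (x∈M ∷ C⊆M) = cong₂ _∷_ (sym (proj₁ (OnM⇒ x∈M))) (map-M-ranks C C⊆M)

    ranks≤n : ∀ C → All OnM C → All (_≤ n) (ranks C)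
    ranks≤n []      []           = []
    ranks≤n (x ∷ C) (x∈M ∷ C⊆M) = proj₂ (OnM⇒ x∈M) ∷ ranks≤n C C⊆M

    map-M-OnM : ∀ c → All OnM (map M[_] c)
    map-M-OnM []      = []
    map-M-OnM (a ∷ c) = atℕ-∈ M a ∷ map-M-OnM c

    IsChain⇒strict : ∀ C → All OnM C → IsChain C → Linked _<_ (ranks C)
    IsChain⇒strict []          _                  _       = []
    IsChain⇒strict (x ∷ [])     _                  _       = [-]
    IsChain⇒strict (x ∷ y ∷ C) (x∈M ∷ y∈M ∷ C⊆M) (x≺y ∷ r) =
      rank-strict x∈M y∈M x≺y ∷ IsChain⇒strict (y ∷ C) (y∈M ∷ C⊆M) r

    strict⇒IsChain : ∀ c → All (_≤ n) c → Linked _<_ c → IsChain (map M[_] c)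
    strict⇒IsChain []          _                  _       = []
    strict⇒IsChain (a ∷ [])     _                  _       = [-]
    strict⇒IsChain (a ∷ b ∷ c) (_ ∷ b≤n ∷ c≤n) (a<b ∷ r) = M-strict a b a<b b≤n ∷ strict⇒IsChain (b ∷ c) (b≤n ∷ c≤n) r

    Interlaces⇒Interlaced-∷ : ∀ {s} x C y D → All OnM (x ∷ C) → All OnM (y ∷ D) → Interlaces (x ∷ C) (y ∷ D) →
                              s ≤ rank x → Interlaced s (ranks (x ∷ C)) (ranks (y ∷ D))
    Interlaces⇒Interlaced-∷ x []       y []       (x∈M ∷ _) (y∈M ∷ _) x≼y s≤x = s≤x , rank-mono x∈M y∈M x≼y , tt
    Interlaces⇒Interlaced-∷ x (x′ ∷ C) y (y′ ∷ D) (x∈M ∷ C⊆M) (y∈M ∷ D⊆M) (x≼y , y≼x′ , r) s≤x =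
      s≤x , rank-mono x∈M y∈M x≼y , Interlaces⇒Interlaced-∷ x′ C y′ D C⊆M D⊆M r (rank-mono y∈M (All.head C⊆M) y≼x′)
    Interlaces⇒Interlaced-∷ x []       y (_ ∷ _) _ _ () _
    Interlaces⇒Interlaced-∷ x (_ ∷ _)  y []      _ _ () _

    Interlaces⇒Interlaced : ∀ C D → All OnM C → All OnM D → Interlaces C D → Interlaced 0 (ranks C) (ranks D)
    Interlaces⇒Interlaced []      []      _    _    _  = tt
    Interlaces⇒Interlaced (x ∷ C) (y ∷ D) C⊆M D⊆M il = Interlaces⇒Interlaced-∷ x C y D C⊆M D⊆M il z≤n
    Interlaces⇒Interlaced []      (_ ∷ []) _ _ ()
    Interlaces⇒Interlaced []      (_ ∷ _ ∷ _) _ _ ()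
    Interlaces⇒Interlaced (_ ∷ [])    [] _ _ ()
    Interlaces⇒Interlaced (_ ∷ _ ∷ _) [] _ _ ()

    Interlaced⇒Interlaces : ∀ {s} c d → All (_≤ n) c → All (_≤ n) d → Interlaced s c d →
                            Interlaces (map M[_] c) (map M[_] d)
    Interlaced⇒Interlaces []           []           _ _ _ = tt
    Interlaced⇒Interlaces (a ∷ [])     (b ∷ [])     _ (b≤n ∷ _) (_ , a≤b , _) = M-mono a b a≤b b≤n
    Interlaced⇒Interlaces (a ∷ a′ ∷ c) (b ∷ b′ ∷ d) (_ ∷ c≤n) (b≤n ∷ d≤n) (_ , a≤b , r@(b≤a′ , _)) =
      M-mono a b a≤b b≤n , M-mono b a′ b≤a′ (All.head c≤n) , Interlaced⇒Interlaces (a′ ∷ c) (b′ ∷ d) c≤n d≤n r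
    Interlaced⇒Interlaces (a ∷ [])     (b ∷ _ ∷ _)  _ _ (_ , _ , ())
    Interlaced⇒Interlaces (a ∷ _ ∷ _)  (b ∷ [])     _ _ (_ , _ , ())

    RankIs⇒ : ∀ C S → RankIs C S → ∀ q → (q ∈ᵇ ranks C) ≡ bitAt S q
    RankIs⇒ C S rankIs q = ⇔→≡ (mk⇔ (λ q∈C → index⇒bitAt S q (proj₁ (rankIs q) (∈ᵇ⇒∈ q _ q∈C)))
                                   (λ q∈S → ∈⇒∈ᵇ _ (proj₂ (rankIs q) (bitAt⇒index S q q∈S))))

    ⇒RankIs : ∀ C S → (∀ q → (q ∈ᵇ ranks C) ≡ bitAt S q) → RankIs C S
    ⇒RankIs C S h q = (λ q∈C → bitAt⇒index S q (trans (sym (h q)) (∈⇒∈ᵇ _ q∈C)))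
                    , (λ q∈S → ∈ᵇ⇒∈ q _ (trans (h q) (index⇒bitAt S q q∈S)))

    -- (C, D, M) ∈ A_ℓ(S), expressed through the ranks of C and D.
    record RankData (ℓ : ℕ) (S : Subset n) (C D : List Carrier) : Set where
      field
        C⊆M        : All OnM C
        D⊆M        : All OnM D
        interlaced : Interlaced 0 (ranks C) (ranks D)
        strict     : Linked _<_ (ranks C)
        ranks-C    : ∀ q → (q ∈ᵇ ranks C) ≡ bitAt S q
        irank      : sum (ranks D) ≡ ℓ + sum (ranks C)
        alternates : Alternates 0 (ranks C) (ranks D)

    InA⇒RankData : ∀ {ℓ S C D} → InA ℓ S (C , D , M) → RankData ℓ S C D
    InA⇒RankData {S = S} {C} {D} (chain , interlaces , rankIs , irank , (_ , C⊆M , D⊆M , incDec)) = record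
      { C⊆M        = C⊆M
      ; D⊆M        = D⊆M
      ; interlaced = Interlaces⇒Interlaced C D C⊆M D⊆M interlaces
      ; strict     = IsChain⇒strict C C⊆M chain
      ; ranks-C    = RankIs⇒ C S rankIs
      ; irank      = irank
      ; alternates = IncDecPattern⇒Alternates 0 C D incDec
      }

    ranks⇒InA : ∀ {ℓ S} c d → Interlaced 0 c d → Linked _<_ c → All (_≤ n) c → All (_≤ n) d →
                (∀ q → (q ∈ᵇ c) ≡ bitAt S q) → sum d ≡ ℓ + sum c → Alternates 0 c d →
                InA ℓ S (map M[_] c , map M[_] d , M)
    ranks⇒InA {ℓ} {S} c d il strict c≤n d≤n c≡S irank alt =
      strict⇒IsChain c c≤n strict ,
      Interlaced⇒Interlaces c d c≤n d≤n il ,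
      ⇒RankIs (map M[_] c) S (λ q → trans (cong (q ∈ᵇ_) ranks-c) (c≡S q)) ,
      subst₂ (λ c′ d′ → sum d′ ≡ ℓ + sum c′) (sym ranks-c) (sym ranks-d) irank ,
      mc , map-M-OnM c , map-M-OnM d ,
      Alternates⇒IncDecPattern 0 (map M[_] c) (map M[_] d) (subst₂ (Alternates 0) (sym ranks-c) (sym ranks-d) alt)
      where
      ranks-c = ranks-map-M c c≤n
      ranks-d = ranks-map-M d d≤n

    -- What the E of a triple of A_ℓ(S) on M satisfies, for t = [· ∈ S] and x = [· ∈ E].
    record Valid (t x : ℕ → Bool) : Set where
      field
        closed   : ∀ q → x (suc q) ≡ true → t q ≡ false → x q ≡ true
        patterns : ∀ v → v < n → patternAt (t v) (x v) (x (suc v)) (ascent v) ≡ true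

    Valid-cong : ∀ {t x x′} → (∀ q → x q ≡ x′ q) → Valid t x → Valid t x′
    Valid-cong {t} x≗x′ valid = record
      { closed   = λ q xs tq → trans (sym (x≗x′ q)) (Valid.closed valid q (trans (x≗x′ (suc q)) xs) tq)
      ; patterns = λ v v<n → subst₂ (λ xv xs → patternAt (t v) xv xs (ascent v) ≡ true) (x≗x′ v) (x≗x′ (suc v))
                                    (Valid.patterns valid v v<n)
      }

    RankData⇒Valid : ∀ {ℓ S C D} → RankData ℓ S C D → Valid (bitAt S) (covered (ranks C) (ranks D))
    RankData⇒Valid {S = S} {C} {D} rd = record
      { closed   = λ q xs tq → covered-closed (ranks C) (ranks D) q xs (trans (ranks-C q) tq)
      ; patterns = patterns
      }
      where
      open RankData rd
      patterns : ∀ v → v < n → patternAt (bitAt S v) (covered (ranks C) (ranks D) v)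
                                         (covered (ranks C) (ranks D) (suc v)) (ascent v) ≡ true
      patterns zero    _   rewrite covered-zero (ranks C) (ranks D) =
        patternAt-start (bitAt S 0) (covered (ranks C) (ranks D) 1)
      patterns (suc v) v<n rewrite sym (ranks-C (suc v)) =
        Alternates⇒pattern 0 (ranks C) (ranks D) interlaced alternates (suc v) (s≤s z≤n) v<n

    module CanonicalProperties (S E : Subset n) (valid : Valid (bitAt S) (inE E)) where
      open Canonical S E public
      open Properties (bitAt-beyond S) refl (inE-beyond E) (Valid.closed valid) public

      canonical∈A : ∀ {ℓ} → ∣ E ∣ ≡ ℓ → InA ℓ S (canonical M S E)
      canonical∈A {ℓ} ∣E∣≡ℓ = ranks⇒InA {ℓ} {S} cs ds cs-ds-Interlaced cs-strict cs≤n ds≤n ∈ᵇ-cs irank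
        (pattern⇒Alternates 0 cs ds cs-ds-Interlaced patterns)
        where
        irank : sum ds ≡ ℓ + sum cs
        irank = begin
          sum ds                                              ≡⟨ sum-Interlaced n cs ds cs-ds-Interlaced cs≤n ds≤n ⟩
          sumTo n (λ i → 𝟙 (covered cs ds (suc i))) + sum cs
            ≡⟨ cong (_+ sum cs) (sumTo-cong n (cong 𝟙 ∘ covered-cs-ds ∘ suc)) ⟩
          sumTo n (𝟙 ∘ bitAt E) + sum cs                      ≡⟨ cong (_+ sum cs) (trans (sym (∣∣-bitAt E)) ∣E∣≡ℓ) ⟩
          ℓ + sum cs                                          ∎
          where open ≡-Reasoning
        patterns : ∀ v → 0 < v → v < n → patternOf cs ds v ≡ true
        patterns v _ v<n rewrite ∈ᵇ-cs v | covered-cs-ds v | covered-cs-ds (suc v) = Valid.patterns valid v v<n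

      covered-canonical : ∀ q → covered (ranks (map M[_] cs)) (ranks (map M[_] ds)) q ≡ inE E q
      covered-canonical q rewrite ranks-map-M cs cs≤n | ranks-map-M ds ds≤n = covered-cs-ds q

      E-of-canonical : E-of (map M[_] cs) (map M[_] ds) ≡ E
      E-of-canonical = trans (tabulate-cong λ i → trans (covered-canonical (suc (toℕ i))) (bitAt-toℕ E i))
                             (tabulate∘lookup E)

    OnM-≡ : ∀ L₁ L₂ → All OnM L₁ → All OnM L₂ → Linked _≤_ (ranks L₁) → Linked _≤_ (ranks L₂) →
            (∀ q → countBelow q (ranks L₁) ≡ countBelow q (ranks L₂)) → L₁ ≡ L₂
    OnM-≡ L₁ L₂ L₁⊆M L₂⊆M sorted₁ sorted₂ counts = begin
      L₁                 ≡⟨ map-M-ranks L₁ L₁⊆M ⟨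
      map M[_] (ranks L₁) ≡⟨ cong (map M[_]) (sorted-≡-by-countBelow (ranks L₁) (ranks L₂) sorted₁ sorted₂ counts) ⟩
      map M[_] (ranks L₂) ≡⟨ map-M-ranks L₂ L₂⊆M ⟩
      L₂                 ∎
      where open ≡-Reasoning

    Valid-minus : ∀ {S : Subset n} {x} (r : Fin n) → Valid (bitAt S) x →
                  Removable (x (toℕ r)) (x (suc (toℕ r))) (ascent (toℕ r)) → Valid (bitAt (S - r)) x
    Valid-minus {S} {x} r valid (closedʳ , patternʳ) = record { closed = closed ; patterns = patterns }
      where
      closed : ∀ q → x (suc q) ≡ true → bitAt (S - r) q ≡ false → x q ≡ true
      closed q xs tq with toℕ r ≟ q
      ... | yes refl = closedʳ xs
      ... | no  r≢q  = Valid.closed valid q xs (trans (sym (bitAt-minus-other S r q r≢q)) tq)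
      patterns : ∀ v → v < n → patternAt (bitAt (S - r) v) (x v) (x (suc v)) (ascent v) ≡ true
      patterns v v<n with toℕ r ≟ v
      ... | yes refl rewrite bitAt-minus-self S r   = patternʳ
      ... | no  r≢v  rewrite bitAt-minus-other S r v r≢v = Valid.patterns valid v v<n

    map-M-≡ : ∀ l L → All (_≤ n) l → All OnM L → Linked _≤_ l → Linked _≤_ (ranks L) →
              (∀ q → countBelow q l ≡ countBelow q (ranks L)) → map M[_] l ≡ L
    map-M-≡ l L l≤n L⊆M sortedˡ sortedᴸ counts =
      OnM-≡ (map M[_] l) L (map-M-OnM l) L⊆M (subst (Linked _≤_) (sym (ranks-map-M l l≤n)) sortedˡ) sortedᴸ
            (λ q → trans (cong (countBelow q) (ranks-map-M l l≤n)) (counts q))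

    insertR-M-≡ : ∀ v l L → v ≤ n → All (_≤ n) l → All OnM L → Linked _≤_ l → Linked _≤_ (ranks L) →
                  (∀ q → 𝟙 (v <ᵇ q) + countBelow q l ≡ countBelow q (ranks L)) → insertR M[ v ] (map M[_] l) ≡ L
    insertR-M-≡ v l L v≤n l≤n L⊆M sortedˡ sortedᴸ counts =
      OnM-≡ (insertR M[ v ] (map M[_] l)) L (All-insertR M[ v ] (map M[_] l) (atℕ-∈ M v) (map-M-OnM l)) L⊆M
            (insertR-sorted M[ v ] (map M[_] l) (subst (Linked _≤_) (sym (ranks-map-M l l≤n)) sortedˡ)) sortedᴸ
            (λ q → trans (countBelow-insertR q M[ v ] (map M[_] l))
                         (trans (cong₂ (λ w l′ → 𝟙 (w <ᵇ q) + countBelow q l′) (rank-M v v≤n) (ranks-map-M l l≤n))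
                                (counts q)))

    image⇒Removable : ∀ {ℓ S T C′ D′ C D} → RankData ℓ S C′ D′ → φ S T (C′ , D′ , M) ≡ (C , D , M) →
                      ∀ v → v < n → bitAt S v ≡ false →
                      Removable (covered (ranks C) (ranks D) v) (covered (ranks C) (ranks D) (suc v)) (ascent v)
    image⇒Removable {S = S} {T} {C′} {D′} rd′ refl v v<n v∉S rewrite covered-foldr-insertR C′ D′ (extra S T M) v
                                                                 | covered-foldr-insertR C′ D′ (extra S T M) (suc v) =
      (λ xs → covered-closed (ranks C′) (ranks D′) v xs (trans (RankData.ranks-C rd′ v) v∉S)) ,
      subst (λ t → patternAt t _ _ (ascent v) ≡ true) v∉S (Valid.patterns (RankData⇒Valid rd′) v v<n)

    uM-lookup : ∀ i → lookup (uM M) i ≡ (if ascent (toℕ i) then 𝐚 else 𝐛)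
    uM-lookup zero    = lookup∘tabulate (uAux (stepLab M)) zero
    uM-lookup (suc j) = trans (lookup∘tabulate (uAux (stepLab M)) (suc j))
      (cong (if_then 𝐚 else 𝐛) (sym (ascent-steps (toℕ j) (inject₁ j) (suc j) (toℕ-inject₁ j) refl)))

    uME-lookup : ∀ E i → lookup (uME M E) i ≡ letter (isB (ascent (toℕ i)) (inE E (toℕ i)) (inE E (suc (toℕ i))))
    uME-lookup E i = begin
      lookup (uME M E) i
        ≡⟨ lookup∘tabulate _ i ⟩
      letterV (lookup (uM M) i) (lookup E i) (prevIn E i)
        ≡⟨ cong₂ (λ u p → letterV u (lookup E i) p) (uM-lookup i) (prevIn-inE E i) ⟩
      letterV (if ascent (toℕ i) then 𝐚 else 𝐛) (lookup E i) (inE E (toℕ i))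
        ≡⟨ letterV-isB (ascent (toℕ i)) (lookup E i) _ ⟩
      letter (isB (ascent (toℕ i)) (inE E (toℕ i)) (lookup E i))
        ≡⟨ cong (letter ∘ isB (ascent (toℕ i)) (inE E (toℕ i))) (bitAt-toℕ E i) ⟨
      letter (isB (ascent (toℕ i)) (inE E (toℕ i)) (inE E (suc (toℕ i)))) ∎
      where open ≡-Reasoning

    WordMatches : Subset n → Subset n → ℕ → Set
    WordMatches E T v = isB (ascent v) (inE E v) (inE E (suc v)) ≡ bitAt T v

    uME≡uT⇒ : ∀ E T → uME M E ≡ uT T → ∀ v → v < n → WordMatches E T v
    uME≡uT⇒ E T u≡ v v<n = subst (WordMatches E T) (toℕ-fromℕ< v<n) (letter-injective (begin
      letter (isB (ascent (toℕ i)) (inE E (toℕ i)) (inE E (suc (toℕ i)))) ≡⟨ uME-lookup E i ⟨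
      lookup (uME M E) i                                                  ≡⟨ cong (λ w → lookup w i) u≡ ⟩
      lookup (uT T) i                                                     ≡⟨ lookup-map i letter T ⟩
      letter (lookup T i)                                                 ≡⟨ cong letter (bitAt-toℕ T i) ⟨
      letter (bitAt T (toℕ i))                                            ∎))
      where
      open ≡-Reasoning
      i = fromℕ< v<n

    ⇒uME≡uT : ∀ E T → (∀ v → v < n → WordMatches E T v) → uME M E ≡ uT T
    ⇒uME≡uT E T matches = trans (sym (tabulate∘lookup (uME M E))) (trans (tabulate-cong λ i → begin
      lookup (uME M E) i                                                  ≡⟨ uME-lookup E i ⟩
      letter (isB (ascent (toℕ i)) (inE E (toℕ i)) (inE E (suc (toℕ i)))) ≡⟨ cong letter (matches (toℕ i) (toℕ<n i)) ⟩
      letter (bitAt T (toℕ i))                                            ≡⟨ cong letter (bitAt-toℕ T i) ⟩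
      letter (lookup T i)                                                 ≡⟨ lookup-map i letter T ⟨
      lookup (uT T) i                                                     ∎) (tabulate∘lookup (uT T)))
      where open ≡-Reasoning

    matches⇒Valid : ∀ E T → (∀ v → v < n → WordMatches E T v) → Valid (bitAt T) (inE E)
    matches⇒Valid E T matches = record { closed = closed ; patterns = patterns }
      where
      closed : ∀ q → inE E (suc q) ≡ true → bitAt T q ≡ false → inE E q ≡ true
      closed q xs tq with q <? n
      ... | yes q<n = isB-closed (ascent q) (inE E q) (inE E (suc q)) xs (trans (matches q q<n) tq)
      ... | no  q≮n = ⊥-elim (false≢true (trans (sym (bitAt-beyond E q (≮⇒≥ q≮n))) xs))
      patterns : ∀ v → v < n → patternAt (bitAt T v) (inE E v) (inE E (suc v)) (ascent v) ≡ true
      patterns v v<n = subst (λ t → patternAt t (inE E v) (inE E (suc v)) (ascent v) ≡ true) (matches v v<n)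
                             (isB-pattern (ascent v) (inE E v) (inE E (suc v)))

    Valid⇒matches : ∀ E T → Valid (bitAt T) (inE E) → ∀ v → v < n →
                    (bitAt T v ≡ true → ¬ Removable (inE E v) (inE E (suc v)) (ascent v)) → WordMatches E T v
    Valid⇒matches E T valid v v<n =
      isB-characterisation (ascent v) (inE E v) (inE E (suc v)) (bitAt T v)
                           (Valid.closed valid v) (Valid.patterns valid v v<n)

    module _ {ℓ S C D} (rd : RankData ℓ S C D) where
      open RankData rd

      inE-E-of : ∀ q → inE (E-of C D) q ≡ covered (ranks C) (ranks D) q
      inE-E-of zero    = sym (covered-zero (ranks C) (ranks D))
      inE-E-of (suc q) with q <? n
      ... | yes q<n = bitAt-tabulate n (covered (ranks C) (ranks D) ∘ suc) q q<n
      ... | no  q≮n = trans (bitAt-beyond (E-of C D) q (≮⇒≥ q≮n))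
        (sym (covered-beyond (ranks C) (ranks D) interlaced (bounded (ranks≤n C C⊆M)) (bounded (ranks≤n D D⊆M))))
        where bounded = All.map (λ r≤n → s≤s (≤-trans r≤n (≮⇒≥ q≮n)))

      ∣E-of∣ : ∣ E-of C D ∣ ≡ ℓ
      ∣E-of∣ = trans (∣tabulate∣ n (covered (ranks C) (ranks D) ∘ suc))
        (+-cancelʳ-≡ (sum (ranks C)) _ _ (trans
          (sym (sum-Interlaced n (ranks C) (ranks D) interlaced (ranks≤n C C⊆M) (ranks≤n D D⊆M))) irank))

      E-of-valid : Valid (bitAt S) (inE (E-of C D))
      E-of-valid = Valid-cong (sym ∘ inE-E-of) (RankData⇒Valid rd)

      canonical-E-of : canonical M S (E-of C D) ≡ (C , D , M)
      canonical-E-of = cong₂ _,_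
        (map-M-≡ cs C cs≤n C⊆M (Linked.map <⇒≤ cs-strict) (Linked.map <⇒≤ strict) counts-c)
        (cong (_, M) (map-M-≡ ds D ds≤n D⊆M ds-sorted (Interlaced-sortedᵈ (ranks C) (ranks D) interlaced) counts-d))
        where
        open CanonicalProperties S (E-of C D) E-of-valid
        counts-c : ∀ q → countBelow q cs ≡ countBelow q (ranks C)
        counts-c = countBelow-from-multiplicity cs (ranks C) λ q →
          trans (multiplicity-cs q) (sym (trans (multiplicity-strict q (ranks C) strict) (cong 𝟙 (ranks-C q))))
        counts-d : ∀ q → countBelow q ds ≡ countBelow q (ranks D)
        counts-d = countBelow-ds (ranks C) (ranks D) interlaced inE-E-of (λ _ → 0) counts-c

      removable⇒image : ∀ v → v < n → bitAt S v ≡ true →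
                        Removable (inE (E-of C D) v) (inE (E-of C D) (suc v)) (ascent v) →
                        Σ (Subset n) λ S′ → S′ ⊂ S × Σ Triple λ y → InA ℓ S′ y × φ S′ S y ≡ (C , D , M)
      removable⇒image v v<n v∈S removable =
        S′ , x∈p⇒p-x⊂p (lookup⇒[]= r S r∈S) , canonical M S′ E , canonical∈A {ℓ} ∣E-of∣ ,
        trans (φ-minus S r _ _ M r∈S)
              (cong₂ _,_ (subst (λ z → insertR z (map M[_] cs) ≡ C) (sym z≡) C≡)
                         (cong (_, M) (subst (λ z → insertR z (map M[_] ds) ≡ D) (sym z≡) D≡)))
        where
        r = fromℕ< v<n
        r≡v = toℕ-fromℕ< v<n
        S′ = S - r
        E = E-of C D
        r∈S : lookup S r ≡ true
        r∈S = trans (sym (bitAt-toℕ S r)) (trans (cong (bitAt S) r≡v) v∈S)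
        removableʳ : Removable (inE E (toℕ r)) (inE E (suc (toℕ r))) (ascent (toℕ r))
        removableʳ = subst (λ w → Removable (inE E w) (inE E (suc w)) (ascent w)) (sym r≡v) removable
        open CanonicalProperties S′ E (Valid-minus {S} r E-of-valid removableʳ)
        z≡ : lookup M (inject₁ r) ≡ M[ v ]
        z≡ = trans (M[inject₁] r) (cong M[_] r≡v)
        counts-c : ∀ q → 𝟙 (v <ᵇ q) + countBelow q cs ≡ countBelow q (ranks C)
        counts-c = countBelow-from-multiplicity (v ∷ cs) (ranks C) λ q → begin
          𝟙 (v ≡ᵇ q) + multiplicity q cs     ≡⟨ cong₂ (λ w m → 𝟙 (w ≡ᵇ q) + m) (sym r≡v) (multiplicity-cs q) ⟩
          𝟙 (toℕ r ≡ᵇ q) + 𝟙 (bitAt S′ q)    ≡⟨ bitAt-minus-𝟙 S r r∈S q ⟩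
          𝟙 (bitAt S q)                      ≡⟨ cong 𝟙 (ranks-C q) ⟨
          𝟙 (q ∈ᵇ ranks C)                   ≡⟨ multiplicity-strict q (ranks C) strict ⟨
          multiplicity q (ranks C)           ∎
          where open ≡-Reasoning
        C≡ : insertR M[ v ] (map M[_] cs) ≡ C
        C≡ = insertR-M-≡ v cs C (<⇒≤ v<n) cs≤n C⊆M (Linked.map <⇒≤ cs-strict) (Linked.map <⇒≤ strict) counts-c
        D≡ : insertR M[ v ] (map M[_] ds) ≡ D
        D≡ = insertR-M-≡ v ds D (<⇒≤ v<n) ds≤n D⊆M ds-sorted (Interlaced-sortedᵈ (ranks C) (ranks D) interlaced)
               (countBelow-ds (ranks C) (ranks D) interlaced inE-E-of (λ q → 𝟙 (v <ᵇ q)) counts-c)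

  InA⇒MaxChain : ∀ {ℓ S C D M} → InA ℓ S (C , D , M) → MaxChain M
  InA⇒MaxChain (_ , _ , _ , _ , mc , _) = mc

  NotImage : ℕ → Subset n → Triple → Set
  NotImage ℓ T x = ¬ (Σ (Subset n) λ S → S ⊂ T × Σ Triple λ y → InA ℓ S y × φ S T y ≡ x)

  B⇒Pairs : ∀ {ℓ T C D M} → InA ℓ T (C , D , M) × NotImage ℓ T (C , D , M) →
            MaxChain M × ∣ E-of C D ∣ ≡ ℓ × uME M (E-of C D) ≡ uT T
  B⇒Pairs {T = T} {C} {D} {M} (inA , notImage) = mc , ∣E-of∣ rd , ⇒uME≡uT (E-of C D) T λ v v<n →
    Valid⇒matches (E-of C D) T (E-of-valid rd) v v<n λ v∈T removable →
      notImage (removable⇒image rd v v<n v∈T removable)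
    where
    mc = InA⇒MaxChain {S = T} inA
    open OnChain M mc
    rd = InA⇒RankData {S = T} inA

  Pairs⇒B : ∀ {ℓ T M E} → MaxChain M × ∣ E ∣ ≡ ℓ × uME M E ≡ uT T →
            InA ℓ T (canonical M T E) × NotImage ℓ T (canonical M T E)
  Pairs⇒B {ℓ} {T} {M} {E} (mc , ∣E∣≡ℓ , u≡) = canonical∈A {ℓ} ∣E∣≡ℓ , notImage
    where
    open OnChain M mc
    matches = uME≡uT⇒ E T u≡
    open CanonicalProperties T E (matches⇒Valid E T matches)
    notImage : NotImage ℓ T (canonical M T E)
    notImage (S , (_ , r , r∈T , r∉S) , (C′ , D′ , M′) , inA′ , φ≡) with cong (proj₂ ∘ proj₂) φ≡
    ... | refl = isB-irremovable (ascent v) (inE E v) (inE E (suc v)) (trans (matches v (toℕ<n r)) v∈T)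
      (subst₂ (λ xv xs → Removable xv xs (ascent v)) (covered-canonical v) (covered-canonical (suc v))
              (image⇒Removable {S = S} {T} (InA⇒RankData inA′) φ≡ v (toℕ<n r) v∉S))
      where
      v = toℕ r
      v∈T : bitAt T v ≡ true
      v∈T = trans (bitAt-toℕ T r) ([]=⇒lookup r∈T)
      v∉S : bitAt S v ≡ false
      v∉S = trans (bitAt-toℕ S r) (¬-not (r∉S ∘ lookup⇒[]= r S))

  E-of∘canonical : ∀ {ℓ T M E} → MaxChain M × ∣ E ∣ ≡ ℓ × uME M E ≡ uT T →
                   E-of (map (atℕ M) (Canonical.cs T E)) (map (atℕ M) (Canonical.ds T E)) ≡ E
  E-of∘canonical {T = T} {M} {E} (mc , _ , u≡) =
    CanonicalProperties.E-of-canonical T E (matches⇒Valid E T (uME≡uT⇒ E T u≡))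
    where open OnChain M mc

  canonical∘E-of : ∀ {ℓ T C D M} → InA ℓ T (C , D , M) × NotImage ℓ T (C , D , M) →
                   canonical M T (E-of C D) ≡ (C , D , M)
  canonical∘E-of {T = T} {M = M} (inA , _) = canonical-E-of (InA⇒RankData {S = T} inA)
    where open OnChain M (InA⇒MaxChain {S = T} inA)

  _≟ᶜ_ : DecidableEquality Carrier
  _≟ᶜ_ = inj⇒≟ (↔⇒↣ (↔-sym enum))

  _≟ᵀ_ : DecidableEquality Triple
  _≟ᵀ_ = ≡-dec (ListP.≡-dec _≟ᶜ_) (≡-dec (ListP.≡-dec _≟ᶜ_) (VecP.≡-dec _≟ᶜ_))

  _≟ᴾ_ : DecidableEquality (Vec Carrier (suc n) × Subset n)
  _≟ᴾ_ = ≡-dec (VecP.≡-dec _≟ᶜ_) (VecP.≡-dec Bool._≟_)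

corollary3p12 : (P : FinPoset) (n : ℕ) (G : PosetDefs.Graded P n)
    (lab : FinPoset.Carrier P → FinPoset.Carrier P → ℕ) →
    PosetDefs.IsRLabeling P lab →
    (ℓ : ℕ) (T : Subset n) →
    PosetDefs.Setup.B P n G lab ℓ T ↔ PosetDefs.Setup.Pairs P n G lab ℓ T
corollary3p12 P n G lab _ ℓ T = mk↔ₛ′ to from to∘from from∘to
  where
  open Main P n G lab
  open PosetDefs.Setup P n G lab using (B; Pairs)

  to : B ℓ T → Pairs ℓ T
  to ((C , D , M) & [ inB ]) = (M , E-of C D) & [ B⇒Pairs inB ]

  from : Pairs ℓ T → B ℓ T
  from ((M , E) & [ pair ]) = canonical M T E & [ Pairs⇒B pair ]

  -- The proofs carried by refinements are irrelevant, so the round-trip equations derived from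
  -- them are recomputed through decidable equality of the underlying values.
  to∘from : ∀ y → to (from y) ≡ y
  to∘from ((M , E) & [ pair ]) =
    value-injective (recompute (_ ≟ᴾ _) (cong (M ,_) (E-of∘canonical {ℓ} {T} {M} pair)))

  from∘to : ∀ x → from (to x) ≡ x
  from∘to (x & [ inB ]) =
    value-injective (recompute (_ ≟ᵀ _) (canonical∘E-of inB))
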